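{- Let $k$ be a positive integer and $n\ge 2$. (a) If $n\le k+2$, then $\dim_{k,f}(P_n)=1$. (b) If $k+3\le n\le 2k+3$, then $\dim_{k,f}(P_n)=\frac{6+2k-n}{5+2k-n}$. (c) Let $n\ge 2k+4$. (i) If $n\equiv 1\pmod{2k+2}$, then $\dim_{k,f}(P_n)=\frac{n+k}{2k+2}$. (ii) If $n\equiv 2,3,\ldots,k+2\pmod{2k+2}$, then $\dim_{k,f}(P_n)=\lceil\frac{n}{2k+2}\rceil$. (iii) If $n\equiv 0\pmod{2k+2}$ or $n\equiv k+3,k+4,\ldots,2k+1\pmod{2k+2}$, then $\lceil\frac{n}{2k+2}\rceil\le\dim_{k,f}(P_n)\le\lceil\frac{n}{2k+2}\rceil+\frac12$.
   Context: $P_n$ is the path on $n$ vertices. $d(x,y)$ denotes the distance in a graph $G$. For a positive integer $k$, $d_k(x,y)=\min\{d(x,y),k+1\}$, and for distinct $x,y\in V(G)$, $R_k\{x,y\}=\{z\in V(G): d_k(x,z)\neq d_k(y,z)\}$. For $g$ defined on $V(G)$ and $U\subseteq V(G)$, $g(U)=\sum_{s\in U}g(s)$. A function $h:V(G)\to[0,1]$ is a $k$-truncated resolving function of $G$ if $h(R_k\{x,y\})\ge 1$ for all distinct $x,y\in V(G)$; $\dim_{k,f}(G)=\min\{h(V(G)): h \text{ is a } k\text{ -truncated resolving function of } G\}$.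
   Formalization: The k-truncated resolving functions h take rational values in $[0,1]$ rather than real ones. -}

module Defs where

open import Data.Nat as ℕ using (ℕ; zero; suc; _+_; _*_; ∣_-_∣; _⊓_)
open import Data.Fin using (Fin; toℕ)
import Data.Fin as Fin
open import Data.Integer using (ℤ; +_)
open import Data.Rational using (ℚ; 0ℚ; 1ℚ; _≤_; _/_) renaming (_+_ to _+ℚ_)
open import Data.Rational.Base using (ceiling)
open import Data.Product using (Σ; _×_; _,_)
open import Relation.Binary.PropositionalEquality using (_≡_; _≢_)
open import Relation.Nullary using (does)
open import Data.Bool using (if_then_else_)

-- The path P_n: vertices Fin n, distance d(i,j) = |i - j|.
dist : ∀ {n} → Fin n → Fin n → ℕ
dist i j = ∣ toℕ i - toℕ j ∣

distK : ∀ {n} → ℕ → Fin n → Fin n → ℕ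
distK k x y = dist x y ⊓ suc k

sumFin : ∀ n → (Fin n → ℚ) → ℚ
sumFin zero    g = 0ℚ
sumFin (suc n) g = g Fin.zero +ℚ sumFin n (λ i → g (Fin.suc i))

weightR : ∀ {n} → ℕ → (Fin n → ℚ) → Fin n → Fin n → ℚ
weightR {n} k g x y =
  sumFin n (λ z → if does (distK k x z ℕ.≟ distK k y z) then 0ℚ else g z)

IsResolving : (k n : ℕ) → (Fin n → ℚ) → Set
IsResolving k n h =
  ((z : Fin n) → (0ℚ ≤ h z) × (h z ≤ 1ℚ)) ×
  ((x y : Fin n) → x ≢ y → 1ℚ ≤ weightR k h x y)

FracDimIs : (k n : ℕ) → ℚ → Set
FracDimIs k n v =
  Σ (Fin n → ℚ) (λ h → IsResolving k n h × sumFin n h ≡ v) ×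
  ((h : Fin n → ℚ) → IsResolving k n h → v ≤ sumFin n h)

FracDimBetween : (k n : ℕ) → ℚ → ℚ → Set
FracDimBetween k n lo hi =
  ((h : Fin n → ℚ) → IsResolving k n h → lo ≤ sumFin n h) ×
  Σ (Fin n → ℚ) (λ h → IsResolving k n h × sumFin n h ≤ hi)

ceilQ : (k n : ℕ) → ℚ
ceilQ k n = ceiling ((+ n) / (2 + 2 * k)) / 1

-- Number the vertices 0, …, n−1.  A vertex resolves the adjacent pair u, u+1 only if it
-- lies within distance k of u or u+1, so a resolving function has weight ≥ 1 on every
-- window of 2k+2 consecutive vertices and on each end segment of k+2 vertices.  Tilings by
-- disjoint windows give the lower bound ⌈n/(2k+2)⌉; for n ≡ 1 (mod 2k+2) the two tilings
-- from opposite ends, together with the pair (0, n−1), cover every vertex exactly twice,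
-- which gives (n+k)/(2k+2); in the middle range the two end segments overlap in vertices
-- each of which is equidistant from its two neighbours.  For the upper bounds, weight ½ on
-- every multiple of k+1 and on n−1 resolves every pair, and in the middle range so does
-- the uniform weight on the central w+3 vertices, since every pair is left unresolved by
-- at most one of them.

module Submission where

open import Defs
open import Algebra.Bundles using (CommutativeMonoid)
open import Data.Bool using (Bool; true; false; T; if_then_else_)
open import Data.Fin as Fin using (Fin; toℕ; fromℕ<)
import Data.Fin.Properties as FP
open import Data.Integer as ℤ using (ℤ; +_; -[1+_]) renaming (suc to sucℤ)
import Data.Integer.DivMod as ℤDM
import Data.Integer.Properties as ZP
open import Data.Integer.Tactic.RingSolver using (solve-∀)
open import Data.List using (_∷_; [])
open import Data.Nat as ℕ using (ℕ; zero; suc; z≤n; s≤s; _+_; _*_; _∸_; _≤_; _<_; _⊓_; ∣_-_∣; _%_; _/_)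
import Data.Nat.DivMod as DM
import Data.Nat.Properties as NP
open import Data.Nat.Tactic.RingSolver using (solve)
open import Data.Product using (Σ-syntax; _×_; _,_; proj₁; proj₂; uncurry)
open import Data.Rational as ℚ using (ℚ; 0ℚ; 1ℚ; ½; mkℚ; floor; ceiling; toℚᵘ)
  renaming (_+_ to _+ℚ_; _*_ to _*ℚ_; _≤_ to _≤ℚ_; _<_ to _<ℚ_; _/_ to _/ℚ_)
import Data.Rational.Properties as QP
open import Data.Rational.Solver using (module +-*-Solver)
open import Data.Rational.Unnormalised as U using (mkℚᵘ; *≡*; *≤*; *<*)
import Data.Rational.Unnormalised.Properties as UP
open import Data.Sum using (_⊎_; inj₁; inj₂)
open import Function using (_∋_; _∘′_)
open import Relation.Binary using (tri<; tri≈; tri>)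
open import Relation.Binary.PropositionalEquality
open import Relation.Nullary using (¬_; yes; no; contradiction)
open import Relation.Nullary.Decidable using (_×-dec_)

open import Algebra.Properties.CommutativeSemigroup (CommutativeMonoid.commutativeSemigroup QP.+-0-commutativeMonoid)
  using () renaming (interchange to +-interchange; xy∙z≈xz∙y to +-swapʳ)

toℚᵘ-/ : ∀ i d → toℚᵘ (i /ℚ suc d) U.≃ mkℚᵘ i d
toℚᵘ-/ i d = QP.toℚᵘ-fromℚᵘ (mkℚᵘ i d)

/-≡-cross : (a b : ℤ) (d e : ℕ) → a ℤ.* + suc e ≡ b ℤ.* + suc d → a /ℚ suc d ≡ b /ℚ suc e
/-≡-cross a b d e eq =
  QP.toℚᵘ-injective (UP.≃-trans (toℚᵘ-/ a d) (UP.≃-trans (*≡* eq) (UP.≃-sym (toℚᵘ-/ b e))))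

/-≡-crossℕ : ∀ a b d e → a * suc e ≡ b * suc d → (+ a) /ℚ suc d ≡ (+ b) /ℚ suc e
/-≡-crossℕ a b d e eq =
  /-≡-cross (+ a) (+ b) d e (trans (sym (ZP.pos-* a (suc e))) (trans (cong +_ eq) (ZP.pos-* b (suc d))))

/-distrib-+ : (a b : ℤ) (d : ℕ) → a /ℚ suc d +ℚ b /ℚ suc d ≡ (a ℤ.+ b) /ℚ suc d
/-distrib-+ a b d = QP.toℚᵘ-injective (UP.≃-trans (QP.toℚᵘ-homo-+ (a /ℚ suc d) (b /ℚ suc d))
  (UP.≃-trans (UP.+-cong (toℚᵘ-/ a d) (toℚᵘ-/ b d)) (UP.≃-trans (*≡* cross) (UP.≃-sym (toℚᵘ-/ (a ℤ.+ b) d)))))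
  where
  cross : (a ℤ.* + suc d ℤ.+ b ℤ.* + suc d) ℤ.* + suc d ≡ (a ℤ.+ b) ℤ.* + (suc d * suc d)
  cross rewrite ZP.pos-* (suc d) (suc d) = identity a b (+ suc d)
    where
    identity : ∀ a b D → (a ℤ.* D ℤ.+ b ℤ.* D) ℤ.* D ≡ (a ℤ.+ b) ℤ.* (D ℤ.* D)
    identity = solve-∀

d/1*a/d≡a/1 : ∀ (a : ℤ) d → ((+ suc d) /ℚ 1) *ℚ (a /ℚ suc d) ≡ a /ℚ 1
d/1*a/d≡a/1 a d = QP.toℚᵘ-injective (UP.≃-trans (QP.toℚᵘ-homo-* ((+ suc d) /ℚ 1) (a /ℚ suc d))
  (UP.≃-trans (UP.*-cong (toℚᵘ-/ (+ suc d) 0) (toℚᵘ-/ a d)) (UP.≃-trans (*≡* cross) (UP.≃-sym (toℚᵘ-/ a 0)))))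
  where
  cross : ((+ suc d) ℤ.* a) ℤ.* + 1 ≡ a ℤ.* + (1 * suc d)
  cross rewrite ZP.pos-* 1 (suc d) = identity a (+ suc d)
    where
    identity : ∀ a D → (D ℤ.* a) ℤ.* + 1 ≡ a ℤ.* (+ 1 ℤ.* D)
    identity = solve-∀

a/1≤d*S⇒a/d≤S : ∀ (a : ℤ) d S → a /ℚ 1 ≤ℚ ((+ suc d) /ℚ 1) *ℚ S → a /ℚ suc d ≤ℚ S
a/1≤d*S⇒a/d≤S a d S h = QP.*-cancelˡ-≤-pos ((+ suc d) /ℚ 1) {{QP.normalize-pos (suc d) 1}}
  (subst (_≤ℚ _) (sym (d/1*a/d≡a/1 a d)) h)

0≤n/d : ∀ n d → 0ℚ ≤ℚ (+ n) /ℚ suc d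
0≤n/d n d = QP.nonNegative⁻¹ _ {{QP.normalize-nonNeg n (suc d)}}

n≤d⇒n/d≤1 : ∀ n d → n ≤ suc d → (+ n) /ℚ suc d ≤ℚ 1ℚ
n≤d⇒n/d≤1 n d n≤d = QP.toℚᵘ-cancel-≤ (UP.≤-respˡ-≃ (UP.≃-sym (toℚᵘ-/ (+ n) d)) (*≤* cross))
  where
  cross : (+ n) ℤ.* + 1 ℤ.≤ + 1 ℤ.* + suc d
  cross = subst₂ ℤ._≤_ (sym (ZP.*-identityʳ (+ n))) (sym (ZP.*-identityˡ (+ suc d))) (ℤ.+≤+ n≤d)

c*d<n⇒c<n/d : ∀ c n d → c * suc d < n → (+ c) /ℚ 1 <ℚ (+ n) /ℚ suc d
c*d<n⇒c<n/d c n d p =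
  QP.toℚᵘ-cancel-< (UP.<-respʳ-≃ (UP.≃-sym (toℚᵘ-/ (+ n) d)) (UP.<-respˡ-≃ (UP.≃-sym (toℚᵘ-/ (+ c) 0)) (*<* cross)))
  where
  cross : + c ℤ.* + suc d ℤ.< + n ℤ.* + 1
  cross = subst₂ ℤ._<_ (ZP.pos-* c (suc d)) (trans (cong +_ (sym (NP.*-identityʳ n))) (ZP.pos-* n 1)) (ℤ.+<+ p)

n≤c*d⇒n/d≤c : ∀ c n d → n ≤ c * suc d → (+ n) /ℚ suc d ≤ℚ (+ c) /ℚ 1
n≤c*d⇒n/d≤c c n d p =
  QP.toℚᵘ-cancel-≤ (UP.≤-respʳ-≃ (UP.≃-sym (toℚᵘ-/ (+ c) 0)) (UP.≤-respˡ-≃ (UP.≃-sym (toℚᵘ-/ (+ n) d)) (*≤* cross)))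
  where
  cross : + n ℤ.* + 1 ℤ.≤ + c ℤ.* + suc d
  cross = subst₂ ℤ._≤_ (trans (cong +_ (sym (NP.*-identityʳ n))) (ZP.pos-* n 1)) (ZP.pos-* c (suc d)) (ℤ.+≤+ p)

0≤½ : 0ℚ ≤ℚ ½
0≤½ = 0≤n/d 1 1

½≤1 : ½ ≤ℚ 1ℚ
½≤1 = n≤d⇒n/d≤1 1 1 (s≤s z≤n)

0≤1 : 0ℚ ≤ℚ 1ℚ
0≤1 = 0≤n/d 1 0

+-cancelʳ-≤ : ∀ a b c → a +ℚ c ≤ℚ b +ℚ c → a ≤ℚ b
+-cancelʳ-≤ a b c le = subst₂ _≤ℚ_ (undo a) (undo b) (QP.+-monoˡ-≤ (ℚ.- c) le)
  where
  undo : ∀ x → (x +ℚ c) +ℚ ℚ.- c ≡ x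
  undo x = trans (QP.+-assoc x c (ℚ.- c)) (trans (cong (x +ℚ_) (QP.+-inverseʳ c)) (QP.+-identityʳ x))

p≤p+q : ∀ {p q} → 0ℚ ≤ℚ q → p ≤ℚ p +ℚ q
p≤p+q {p} 0≤q = QP.≤-trans (QP.≤-reflexive (sym (QP.+-identityʳ p))) (QP.+-monoʳ-≤ p 0≤q)

p≤q+p : ∀ {p q} → 0ℚ ≤ℚ q → p ≤ℚ q +ℚ p
p≤q+p {p} {q} 0≤q = subst (p ≤ℚ_) (QP.+-comm p q) (p≤p+q 0≤q)

1+j/1 : ∀ j → 1ℚ +ℚ (+ j) /ℚ 1 ≡ (+ suc j) /ℚ 1
1+j/1 j = /-distrib-+ (+ 1) (+ j) 0

i<1+j⇒i≤j : ∀ {i j} → i ℤ.< sucℤ j → i ℤ.≤ j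
i<1+j⇒i≤j {i} {j} p = subst (i ℤ.≤_) (ZP.pred-suc j) (ZP.i<j⇒i≤pred[j] p)

floor-unique : ∀ p (f : ℤ) → f /ℚ 1 ≤ℚ p → p <ℚ (f ℤ.+ + 1) /ℚ 1 → floor p ≡ f
floor-unique p@(mkℚ N E _) f f≤p p<f+1 = ZP.≤-antisym q≤f f≤q
  where
  f*E≤N : f ℤ.* + suc E ℤ.≤ N
  f*E≤N with UP.≤-respˡ-≃ (toℚᵘ-/ f 0) (QP.toℚᵘ-mono-≤ f≤p)
  ... | *≤* x = subst (f ℤ.* + suc E ℤ.≤_) (ZP.*-identityʳ N) x
  N<[f+1]*E : N ℤ.< sucℤ f ℤ.* + suc E
  N<[f+1]*E with UP.<-respʳ-≃ (toℚᵘ-/ (f ℤ.+ + 1) 0) (QP.toℚᵘ-mono-< p<f+1)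
  ... | U.*<* x = subst₂ (λ a b → a ℤ.< b ℤ.* + suc E) (ZP.*-identityʳ N) (ZP.+-comm f (+ 1)) x
  q≡ : floor p ≡ N ℤDM./ℕ suc E
  q≡ = ℤDM.div-pos-is-/ℕ N (suc E)
  f≤q : f ℤ.≤ floor p
  f≤q = subst (f ℤ.≤_) (sym q≡) (i<1+j⇒i≤j (ZP.*-cancelʳ-<-nonNeg (+ suc E)
          (ZP.≤-<-trans f*E≤N (ℤDM.n<s[n/ℕd]*d N (suc E)))))
  q≤f : floor p ℤ.≤ f
  q≤f = subst (ℤ._≤ f) (sym q≡) (i<1+j⇒i≤j (ZP.*-cancelʳ-<-nonNeg (+ suc E)
          (ZP.≤-<-trans (ℤDM.[n/ℕd]*d≤n N (suc E)) N<[f+1]*E)))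

ceiling-unique : ∀ p c → (+ c) /ℚ 1 <ℚ p → p ≤ℚ (+ suc c) /ℚ 1 → ceiling p ≡ + suc c
ceiling-unique p@(mkℚ _ _ _) c c<p p≤c+1 = cong ℤ.-_ floor-neg
  where
  -c≡ : (-[1+ c ] ℤ.+ + 1) /ℚ 1 ≡ ℚ.- ((+ c) /ℚ 1)
  -c≡ = trans (cong (_/ℚ 1) (trans (ZP.+-comm -[1+ c ] (+ 1)) (ZP.1-[1+n]≡-n c))) (neg/1 c)
    where
    neg/1 : ∀ c → (ℤ.- (+ c)) /ℚ 1 ≡ ℚ.- ((+ c) /ℚ 1)
    neg/1 zero    = refl
    neg/1 (suc c) = refl
  floor-neg : floor (ℚ.- p) ≡ -[1+ c ]
  floor-neg = floor-unique (ℚ.- p) -[1+ c ] (QP.neg-antimono-≤ p≤c+1)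
                (subst (ℚ.- p <ℚ_) (sym -c≡) (QP.neg-antimono-< c<p))

ceilQ≡ : ∀ k n c → c * (2 + 2 * k) < n → n ≤ suc c * (2 + 2 * k) → ceilQ k n ≡ (+ suc c) /ℚ 1
ceilQ≡ k n c lower upper = cong (_/ℚ 1) (ceiling-unique ((+ n) /ℚ (2 + 2 * k)) c
  (c*d<n⇒c<n/d c n (1 + 2 * k) lower) (n≤c*d⇒n/d≤c (suc c) n (1 + 2 * k) upper))

∑ : (ℕ → ℚ) → ℕ → ℚ
∑ f zero    = 0ℚ
∑ f (suc n) = f 0 +ℚ ∑ (λ i → f (suc i)) n

∑-cong : ∀ n {f g : ℕ → ℚ} → (∀ i → i < n → f i ≡ g i) → ∑ f n ≡ ∑ g n
∑-cong zero    f≡g = refl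
∑-cong (suc n) f≡g = cong₂ _+ℚ_ (f≡g 0 (s≤s z≤n)) (∑-cong n (λ i i<n → f≡g (suc i) (s≤s i<n)))

∑-mono-≤ : ∀ n {f g : ℕ → ℚ} → (∀ i → i < n → f i ≤ℚ g i) → ∑ f n ≤ℚ ∑ g n
∑-mono-≤ zero    f≤g = QP.≤-refl
∑-mono-≤ (suc n) f≤g = QP.+-mono-≤ (f≤g 0 (s≤s z≤n)) (∑-mono-≤ n (λ i i<n → f≤g (suc i) (s≤s i<n)))

∑-zero : ∀ n {f : ℕ → ℚ} → (∀ i → i < n → f i ≡ 0ℚ) → ∑ f n ≡ 0ℚ
∑-zero n {f} f≡0 = trans (∑-cong n f≡0) (zeros n)
  where
  zeros : ∀ n → ∑ (λ _ → 0ℚ) n ≡ 0ℚ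
  zeros zero    = refl
  zeros (suc n) = trans (QP.+-identityˡ _) (zeros n)

∑-nonNeg : ∀ n {f : ℕ → ℚ} → (∀ i → i < n → 0ℚ ≤ℚ f i) → 0ℚ ≤ℚ ∑ f n
∑-nonNeg n 0≤f = QP.≤-trans (QP.≤-reflexive (sym (∑-zero n (λ _ _ → refl)))) (∑-mono-≤ n 0≤f)

∑-distrib-+ : ∀ n (f g : ℕ → ℚ) → ∑ (λ i → f i +ℚ g i) n ≡ ∑ f n +ℚ ∑ g n
∑-distrib-+ zero    f g = refl
∑-distrib-+ (suc n) f g =
  trans (cong (f 0 +ℚ g 0 +ℚ_) (∑-distrib-+ n (λ i → f (suc i)) (λ i → g (suc i))))
        (+-interchange (f 0) (g 0) _ _)

∑-split : ∀ a b (f : ℕ → ℚ) → ∑ f (a + b) ≡ ∑ f a +ℚ ∑ (λ i → f (a + i)) b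
∑-split zero    b f = sym (QP.+-identityˡ _)
∑-split (suc a) b f =
  trans (cong (f 0 +ℚ_) (∑-split a b (λ i → f (suc i)))) (sym (QP.+-assoc (f 0) _ _))

point : ℕ → ℚ → ℕ → ℚ
point a c i with i ℕ.≟ a
... | yes _ = c
... | no  _ = 0ℚ

point-nonNeg : ∀ a {c} → 0ℚ ≤ℚ c → ∀ i → 0ℚ ≤ℚ point a c i
point-nonNeg a 0≤c i with i ℕ.≟ a
... | yes _ = 0≤c
... | no  _ = QP.≤-refl

∑-point : ∀ n a c → a < n → ∑ (point a c) n ≡ c
∑-point (suc n) zero c _ =
  trans (cong (c +ℚ_) (∑-zero n (λ _ _ → refl))) (QP.+-identityʳ c)
∑-point (suc n) (suc a) c (s≤s a<n) =
  trans (QP.+-identityˡ _) (trans (∑-cong n (λ i _ → shift i)) (∑-point n a c a<n))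
  where
  shift : ∀ i → point (suc a) c (suc i) ≡ point a c i
  shift i with suc i ℕ.≟ suc a | i ℕ.≟ a
  ... | yes _    | yes _   = refl
  ... | no  _    | no  _   = refl
  ... | yes 1+i≡1+a | no i≢a = contradiction (NP.suc-injective 1+i≡1+a) i≢a
  ... | no  1+i≢1+a | yes i≡a = contradiction (cong suc i≡a) 1+i≢1+a

∑-point-≤ : ∀ n a {c} → 0ℚ ≤ℚ c → ∑ (point a c) n ≤ℚ c
∑-point-≤ n a {c} 0≤c with a ℕ.<? n
... | yes a<n = QP.≤-reflexive (∑-point n a c a<n)
... | no  a≮n = QP.≤-trans (QP.≤-reflexive (∑-zero n outside)) 0≤c
  where
  outside : ∀ i → i < n → point a c i ≡ 0ℚ
  outside i i<n with i ℕ.≟ a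
  ... | yes refl = contradiction i<n a≮n
  ... | no  _    = refl

∑-const : ∀ j S → ∑ (λ _ → S) j ≡ ((+ j) /ℚ 1) *ℚ S
∑-const zero    S = sym (QP.*-zeroˡ S)
∑-const (suc j) S = begin
  S +ℚ ∑ (λ _ → S) j                  ≡⟨ cong₂ _+ℚ_ (sym (QP.*-identityˡ S)) (∑-const j S) ⟩
  1ℚ *ℚ S +ℚ ((+ j) /ℚ 1) *ℚ S        ≡⟨ sym (QP.*-distribʳ-+ S 1ℚ ((+ j) /ℚ 1)) ⟩
  (1ℚ +ℚ (+ j) /ℚ 1) *ℚ S             ≡⟨ cong (_*ℚ S) (/-distrib-+ (+ 1) (+ j) 0) ⟩
  ((+ suc j) /ℚ 1) *ℚ S               ∎
  where open ≡-Reasoning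

∑-const-1/d : ∀ j d → ∑ (λ _ → (+ 1) /ℚ suc d) j ≡ (+ j) /ℚ suc d
∑-const-1/d zero    d = sym (QP.0/n≡0 (suc d))
∑-const-1/d (suc j) d = trans (cong ((+ 1) /ℚ suc d +ℚ_) (∑-const-1/d j d)) (/-distrib-+ (+ 1) (+ j) d)

extend : ∀ {n} → (Fin n → ℚ) → ℕ → ℚ
extend {n} h i with i ℕ.<? n
... | yes i<n = h (fromℕ< i<n)
... | no  _   = 0ℚ

extend-toℕ : ∀ {n} (h : Fin n → ℚ) (z : Fin n) → h z ≡ extend h (toℕ z)
extend-toℕ {n} h z with toℕ z ℕ.<? n
... | yes z<n = cong h (sym (FP.fromℕ<-toℕ z z<n))
... | no  z≮n = contradiction (FP.toℕ<n z) z≮n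

sumFin≡∑ : ∀ n f → sumFin n (λ z → f (toℕ z)) ≡ ∑ f n
sumFin≡∑ zero    f = refl
sumFin≡∑ (suc n) f = cong (f 0 +ℚ_) (sumFin≡∑ n (λ i → f (suc i)))

sumFin-cong : ∀ n {g g′ : Fin n → ℚ} → (∀ z → g z ≡ g′ z) → sumFin n g ≡ sumFin n g′
sumFin-cong zero    g≡g′ = refl
sumFin-cong (suc n) g≡g′ = cong₂ _+ℚ_ (g≡g′ Fin.zero) (sumFin-cong n (λ z → g≡g′ (Fin.suc z)))

sumFin≡∑-extend : ∀ n (h : Fin n → ℚ) → sumFin n h ≡ ∑ (extend h) n
sumFin≡∑-extend n h = trans (sumFin-cong n (extend-toℕ h)) (sumFin≡∑ n (extend h))

≡ᵇ-true : ∀ {m n} → m ≡ n → (m ℕ.≡ᵇ n) ≡ true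
≡ᵇ-true {zero}  refl = refl
≡ᵇ-true {suc m} refl = ≡ᵇ-true {m} refl

≡ᵇ-true⇒≡ : ∀ {m n} → (m ℕ.≡ᵇ n) ≡ true → m ≡ n
≡ᵇ-true⇒≡ {m} {n} eq = NP.≡ᵇ⇒≡ m n (subst T (sym eq) _)

≡ᵇ-false : ∀ {m n} → m ≢ n → (m ℕ.≡ᵇ n) ≡ false
≡ᵇ-false {m} {n} m≢n with m ℕ.≡ᵇ n in eq
... | true  = contradiction (≡ᵇ-true⇒≡ eq) m≢n
... | false = refl

-- sameDistK k x y i is false exactly when i ∈ R_k{x,y}.
sameDistK : ℕ → ℕ → ℕ → ℕ → Bool
sameDistK k x y i = ∣ x - i ∣ ⊓ suc k ℕ.≡ᵇ ∣ y - i ∣ ⊓ suc k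

sameDistK-sym : ∀ k x y i → sameDistK k x y i ≡ sameDistK k y x i
sameDistK-sym k x y i with ∣ x - i ∣ ⊓ suc k ℕ.≟ ∣ y - i ∣ ⊓ suc k
... | yes e  = trans (≡ᵇ-true e) (sym (≡ᵇ-true (sym e)))
... | no  ne = trans (≡ᵇ-false ne) (sym (≡ᵇ-false (λ e → ne (sym e))))

nearer-x-resolves : ∀ k x y i → ∣ x - i ∣ ≤ k → ∣ x - i ∣ < ∣ y - i ∣ → sameDistK k x y i ≡ false
nearer-x-resolves k x y i u≤k u<v = ≡ᵇ-false (NP.<⇒≢ (subst (_< _) (sym u⊓≡u) (NP.⊓-glb u<v (s≤s u≤k))))
  where
  u⊓≡u : ∣ x - i ∣ ⊓ suc k ≡ ∣ x - i ∣
  u⊓≡u = NP.m≤n⇒m⊓n≡m (NP.m≤n⇒m≤1+n u≤k)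

nearer-y-resolves : ∀ k x y i → ∣ y - i ∣ ≤ k → ∣ y - i ∣ < ∣ x - i ∣ → sameDistK k x y i ≡ false
nearer-y-resolves k x y i v≤k v<u = trans (sameDistK-sym k x y i) (nearer-x-resolves k y x i v≤k v<u)

module _ (k x y i : ℕ) where

  far-unresolved : suc k ≤ ∣ x - i ∣ → suc k ≤ ∣ y - i ∣ → sameDistK k x y i ≡ true
  far-unresolved k<u k<v = ≡ᵇ-true (trans (NP.m≥n⇒m⊓n≡n k<u) (sym (NP.m≥n⇒m⊓n≡n k<v)))

  equidistant-unresolved : ∣ x - i ∣ ≡ ∣ y - i ∣ → sameDistK k x y i ≡ true
  equidistant-unresolved u≡v = ≡ᵇ-true (cong (_⊓ suc k) u≡v)

  unresolved-view : sameDistK k x y i ≡ true →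
                    (∣ x - i ∣ ≡ ∣ y - i ∣) ⊎ (suc k ≤ ∣ x - i ∣ × suc k ≤ ∣ y - i ∣)
  unresolved-view t with ≡ᵇ-true⇒≡ t | ∣ x - i ∣ ℕ.<? suc k | ∣ y - i ∣ ℕ.<? suc k
  ... | e | yes p | yes q = inj₁ (trans (sym (NP.m≤n⇒m⊓n≡m (NP.<⇒≤ p))) (trans e (NP.m≤n⇒m⊓n≡m (NP.<⇒≤ q))))
  ... | e | yes p | no  q = contradiction (trans (sym (NP.m≤n⇒m⊓n≡m (NP.<⇒≤ p))) (trans e (NP.m≥n⇒m⊓n≡n (NP.≮⇒≥ q)))) (NP.<⇒≢ p)
  ... | e | no  p | yes q = contradiction (trans (sym (NP.m≤n⇒m⊓n≡m (NP.<⇒≤ q))) (trans (sym e) (NP.m≥n⇒m⊓n≡n (NP.≮⇒≥ p)))) (NP.<⇒≢ q)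
  ... | e | no  p | no  q = inj₂ (NP.≮⇒≥ p , NP.≮⇒≥ q)

∣m+n-m∣≡n : ∀ m n → ∣ m + n - m ∣ ≡ n
∣m+n-m∣≡n m n = trans (NP.∣-∣-comm (m + n) m) (NP.∣m-m+n∣≡n m n)

resolves-from-below : ∀ k {x y a} → a ≤ x → x < y → x ∸ a ≤ k → sameDistK k x y a ≡ false
resolves-from-below k {x} {y} {a} a≤x x<y x∸a≤k = nearer-x-resolves k x y a
  (subst (_≤ k) (sym (NP.m≤n⇒∣n-m∣≡n∸m a≤x)) x∸a≤k)
  (subst₂ _<_ (sym (NP.m≤n⇒∣n-m∣≡n∸m a≤x)) (sym (NP.m≤n⇒∣n-m∣≡n∸m (NP.≤-trans a≤x (NP.<⇒≤ x<y))))
    (NP.∸-monoˡ-< x<y a≤x))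

resolves-from-above : ∀ k {x y s} → x < y → y ≤ s → s ∸ y ≤ k → sameDistK k x y s ≡ false
resolves-from-above k {x} {y} {s} x<y y≤s s∸y≤k = nearer-y-resolves k x y s
  (subst (_≤ k) (sym (NP.m≤n⇒∣m-n∣≡n∸m y≤s)) s∸y≤k)
  (subst₂ _<_ (sym (NP.m≤n⇒∣m-n∣≡n∸m y≤s)) (sym (NP.m≤n⇒∣m-n∣≡n∸m (NP.≤-trans (NP.<⇒≤ x<y) y≤s)))
    (NP.∸-monoʳ-< x<y y≤s))

weightRℕ : ℕ → (ℕ → ℚ) → ℕ → ℕ → ℕ → ℚ
weightRℕ k H x y n = ∑ (λ i → if sameDistK k x y i then 0ℚ else H i) n

weightR≡weightRℕ : ∀ k n (h : Fin n → ℚ) (x y : Fin n) →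
                   weightR k h x y ≡ weightRℕ k (extend h) (toℕ x) (toℕ y) n
weightR≡weightRℕ k n h x y =
  trans (sumFin-cong n (λ z → cong (if sameDistK k (toℕ x) (toℕ y) (toℕ z) then 0ℚ else_) (extend-toℕ h z)))
        (sumFin≡∑ n (λ i → if sameDistK k (toℕ x) (toℕ y) i then 0ℚ else extend h i))

weightRℕ-sym : ∀ k H x y n → weightRℕ k H x y n ≡ weightRℕ k H y x n
weightRℕ-sym k H x y n = ∑-cong n (λ i _ → cong (λ b → if b then 0ℚ else H i) (sameDistK-sym k x y i))

weightRℕ-≤ : ∀ k H x y n (G : ℕ → ℚ) → (∀ i → i < n → 0ℚ ≤ℚ G i) →
             (∀ i → i < n → sameDistK k x y i ≡ false → H i ≤ℚ G i) → weightRℕ k H x y n ≤ℚ ∑ G n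
weightRℕ-≤ k H x y n G 0≤G H≤G = ∑-mono-≤ n pointwise
  where
  pointwise : ∀ i → i < n → (if sameDistK k x y i then 0ℚ else H i) ≤ℚ G i
  pointwise i i<n with sameDistK k x y i in e
  ... | true  = 0≤G i i<n
  ... | false = H≤G i i<n e

weightRℕ-≥ : ∀ k H x y n (G : ℕ → ℚ) → (∀ i → i < n → sameDistK k x y i ≡ true → G i ≤ℚ 0ℚ) →
             (∀ i → i < n → sameDistK k x y i ≡ false → G i ≤ℚ H i) → ∑ G n ≤ℚ weightRℕ k H x y n
weightRℕ-≥ k H x y n G G≤0 G≤H = ∑-mono-≤ n pointwise
  where
  pointwise : ∀ i → i < n → G i ≤ℚ (if sameDistK k x y i then 0ℚ else H i)
  pointwise i i<n with sameDistK k x y i in e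
  ... | true  = G≤0 i i<n e
  ... | false = G≤H i i<n e

weightRℕ≤∑ : ∀ k H x y n → (∀ i → 0ℚ ≤ℚ H i) → weightRℕ k H x y n ≤ℚ ∑ H n
weightRℕ≤∑ k H x y n 0≤H = weightRℕ-≤ k H x y n H (λ i _ → 0≤H i) (λ _ _ _ → QP.≤-refl)

extend-nonNeg : ∀ {k n} (h : Fin n → ℚ) → IsResolving k n h → ∀ i → 0ℚ ≤ℚ extend h i
extend-nonNeg {n = n} h R i with i ℕ.<? n
... | yes i<n = proj₁ (proj₁ R (fromℕ< i<n))
... | no  _   = QP.≤-refl

resolving⇒weightRℕ≥1 : ∀ {k n} (h : Fin n → ℚ) → IsResolving k n h →
                       ∀ x y → x < n → y < n → x ≢ y → 1ℚ ≤ℚ weightRℕ k (extend h) x y n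
resolving⇒weightRℕ≥1 {k} {n} h R x y x<n y<n x≢y =
  subst (1ℚ ≤ℚ_) (trans (weightR≡weightRℕ k n h x′ y′) (cong₂ (λ a b → weightRℕ k (extend h) a b n) (FP.toℕ-fromℕ< x<n) (FP.toℕ-fromℕ< y<n)))
    (proj₂ R x′ y′ λ x′≡y′ → x≢y (trans (sym (FP.toℕ-fromℕ< x<n)) (trans (cong toℕ x′≡y′) (FP.toℕ-fromℕ< y<n))))
  where
  x′ = fromℕ< x<n
  y′ = fromℕ< y<n

resolving-fromℕ : ∀ k n (H : ℕ → ℚ) → (∀ i → 0ℚ ≤ℚ H i) → (∀ i → H i ≤ℚ 1ℚ) →
                  (∀ x y → x < y → y < n → 1ℚ ≤ℚ weightRℕ k H x y n) → IsResolving k n (λ z → H (toℕ z))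
resolving-fromℕ k n H 0≤H H≤1 resolves = (λ z → 0≤H (toℕ z) , H≤1 (toℕ z)) , pairs
  where
  pairs : (x y : Fin n) → x ≢ y → 1ℚ ≤ℚ weightR k (λ z → H (toℕ z)) x y
  pairs x y x≢y with NP.<-cmp (toℕ x) (toℕ y)
  ... | tri< x<y _ _ = subst (1ℚ ≤ℚ_) (sym (sumFin≡∑ n _)) (resolves _ _ x<y (FP.toℕ<n y))
  ... | tri≈ _ x≡y _ = contradiction (FP.toℕ-injective x≡y) x≢y
  ... | tri> _ _ y<x = subst (1ℚ ≤ℚ_) (sym (trans (sumFin≡∑ n _) (weightRℕ-sym k H (toℕ x) (toℕ y) n)))
                         (resolves _ _ y<x (FP.toℕ<n x))

restrict : ℕ → ℕ → (ℕ → ℚ) → ℕ → ℚ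
restrict a b f i with a ℕ.≤? i | i ℕ.<? b
... | yes _ | yes _ = f i
... | _     | _     = 0ℚ

data Position (a b i : ℕ) : Set where
  below  : i < a → Position a b i
  inside : a ≤ i → i < b → Position a b i
  above  : b ≤ i → Position a b i

position : ∀ a b i → Position a b i
position a b i with i ℕ.<? a | i ℕ.<? b
... | yes i<a | _       = below i<a
... | no  i≮a | yes i<b = inside (NP.≮⇒≥ i≮a) i<b
... | no  _   | no  i≮b = above (NP.≮⇒≥ i≮b)

restrict-inside : ∀ a b f {i} → a ≤ i → i < b → restrict a b f i ≡ f i
restrict-inside a b f {i} a≤i i<b with a ℕ.≤? i | i ℕ.<? b
... | yes _   | yes _   = refl
... | no  a≰i | _       = contradiction a≤i a≰i
... | yes _   | no  i≮b = contradiction i<b i≮b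

restrict-below : ∀ a b f {i} → i < a → restrict a b f i ≡ 0ℚ
restrict-below a b f {i} i<a with a ℕ.≤? i
... | yes a≤i = contradiction a≤i (NP.<⇒≱ i<a)
... | no  _   = refl

restrict-above : ∀ a b f {i} → b ≤ i → restrict a b f i ≡ 0ℚ
restrict-above a b f {i} b≤i with a ℕ.≤? i | i ℕ.<? b
... | yes _ | yes i<b = contradiction b≤i (NP.<⇒≱ i<b)
... | yes _ | no  _   = refl
... | no  _ | _       = refl

restrict-nonNeg : ∀ a b f → (∀ i → 0ℚ ≤ℚ f i) → ∀ i → 0ℚ ≤ℚ restrict a b f i
restrict-nonNeg a b f 0≤f i with position a b i
... | below  i<a     = QP.≤-reflexive (sym (restrict-below a b f i<a))
... | inside a≤i i<b = subst (0ℚ ≤ℚ_) (sym (restrict-inside a b f a≤i i<b)) (0≤f i)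
... | above  b≤i     = QP.≤-reflexive (sym (restrict-above a b f b≤i))

∑-restrict : ∀ a L f n → a + L ≤ n → ∑ (restrict a (a + L) f) n ≡ ∑ (λ i → f (a + i)) L
∑-restrict a L f n a+L≤n with NP.m≤n⇒∃[o]m+o≡n a+L≤n
... | R , refl = begin
  ∑ F (a + L + R)                                   ≡⟨ ∑-split (a + L) R F ⟩
  ∑ F (a + L) +ℚ ∑ (λ i → F (a + L + i)) R          ≡⟨ cong₂ _+ℚ_ (∑-split a L F) (∑-zero R (λ i _ → after i)) ⟩
  (∑ F a +ℚ ∑ (λ i → F (a + i)) L) +ℚ 0ℚ           ≡⟨ QP.+-identityʳ _ ⟩
  ∑ F a +ℚ ∑ (λ i → F (a + i)) L                    ≡⟨ cong₂ _+ℚ_ (∑-zero a (λ i → restrict-below a (a + L) f)) (∑-cong L within) ⟩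
  0ℚ +ℚ ∑ (λ i → f (a + i)) L                       ≡⟨ QP.+-identityˡ _ ⟩
  ∑ (λ i → f (a + i)) L                             ∎
  where
  open ≡-Reasoning
  F = restrict a (a + L) f
  after : ∀ i → F (a + L + i) ≡ 0ℚ
  after i = restrict-above a (a + L) f (NP.m≤m+n (a + L) i)
  within : ∀ i → i < L → F (a + i) ≡ f (a + i)
  within i i<L = restrict-inside a (a + L) f (NP.m≤m+n a i) (NP.+-monoʳ-< a i<L)

≤-by-+ : ∀ {a b} c → a + c ≡ b → a ≤ b
≤-by-+ {a} c refl = NP.m≤m+n a c

<-by-+ : ∀ {a b} c → suc (a + c) ≡ b → a < b
<-by-+ {a} c refl = s≤s (NP.m≤m+n a c)

≤-cong : ∀ {a b a′ b′} → a ≤ b → a ≡ a′ → b ≡ b′ → a′ ≤ b′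
≤-cong p refl refl = p

-- Lower bounds from windows

resolver-close : ∀ k x y i → sameDistK k x y i ≡ false → ∣ x - i ∣ ≤ k ⊎ ∣ y - i ∣ ≤ k
resolver-close k x y i resolved with ∣ x - i ∣ ℕ.≤? k | ∣ y - i ∣ ℕ.≤? k
... | yes u≤k | _       = inj₁ u≤k
... | no  _   | yes v≤k = inj₂ v≤k
... | no  u≰k | no  v≰k =
  contradiction (trans (sym (far-unresolved k x y i (NP.≰⇒> u≰k) (NP.≰⇒> v≰k))) resolved) (λ ())

∣x-i∣≤k⇒x≤i+k : ∀ {x i k} → ∣ x - i ∣ ≤ k → x ≤ i + k
∣x-i∣≤k⇒x≤i+k {x} {i} d≤k = NP.≤-trans (NP.m≤n+∣m-n∣ x i) (NP.+-monoʳ-≤ i d≤k)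

∣x-i∣≤k⇒i≤x+k : ∀ {x i k} → ∣ x - i ∣ ≤ k → i ≤ x + k
∣x-i∣≤k⇒i≤x+k {x} {i} d≤k = NP.≤-trans (NP.m≤n+∣n-m∣ i x) (NP.+-monoʳ-≤ x d≤k)

adjacent-resolver : ∀ k x i → sameDistK k x (suc x) i ≡ false → x ≤ i + k × i ≤ suc (x + k)
adjacent-resolver k x i resolved with resolver-close k x (suc x) i resolved
... | inj₁ close = ∣x-i∣≤k⇒x≤i+k close , NP.m≤n⇒m≤1+n (∣x-i∣≤k⇒i≤x+k close)
... | inj₂ close = NP.≤-trans (NP.n≤1+n x) (∣x-i∣≤k⇒x≤i+k close) , ∣x-i∣≤k⇒i≤x+k close

module IntervalMass (n : ℕ) (H : ℕ → ℚ) (0≤H : ∀ i → 0ℚ ≤ℚ H i) where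

  total : ℚ
  total = ∑ H n

  mass : ℕ → ℕ → ℚ
  mass a b = ∑ (restrict a b H) n

  private
    restrict-merge : ∀ a b c i → a ≤ b → b ≤ c → restrict a b H i +ℚ restrict b c H i ≡ restrict a c H i
    restrict-merge a b c i a≤b b≤c with position a b i
    ... | below i<a rewrite restrict-below a b H i<a | restrict-below b c H (NP.<-≤-trans i<a a≤b)
                          | restrict-below a c H i<a = QP.+-identityˡ 0ℚ
    ... | inside a≤i i<b rewrite restrict-inside a b H a≤i i<b | restrict-below b c H i<b
                               | restrict-inside a c H a≤i (NP.<-≤-trans i<b b≤c) = QP.+-identityʳ (H i)
    ... | above b≤i with position b c i
    ...   | below i<b = contradiction b≤i (NP.<⇒≱ i<b)
    ...   | inside _ i<c rewrite restrict-above a b H b≤i | restrict-inside b c H b≤i i<c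
                               | restrict-inside a c H (NP.≤-trans a≤b b≤i) i<c = QP.+-identityˡ (H i)
    ...   | above c≤i rewrite restrict-above a b H b≤i | restrict-above b c H c≤i
                            | restrict-above a c H c≤i = QP.+-identityˡ 0ℚ

    restrict-≤ : ∀ a b i → restrict a b H i ≤ℚ H i
    restrict-≤ a b i with position a b i
    ... | below  i<a     rewrite restrict-below a b H i<a      = 0≤H i
    ... | inside a≤i i<b rewrite restrict-inside a b H a≤i i<b = QP.≤-refl
    ... | above  b≤i     rewrite restrict-above a b H b≤i      = 0≤H i

    restrict-disjoint : ∀ a b c d i → b ≤ c → restrict a b H i +ℚ restrict c d H i ≤ℚ H i
    restrict-disjoint a b c d i b≤c with position a b i
    ... | inside a≤i i<b rewrite restrict-inside a b H a≤i i<b | restrict-below c d H (NP.<-≤-trans i<b b≤c) =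
      QP.≤-reflexive (QP.+-identityʳ (H i))
    ... | below i<a rewrite restrict-below a b H i<a = subst (_≤ℚ H i) (sym (QP.+-identityˡ _)) (restrict-≤ c d i)
    ... | above b≤i rewrite restrict-above a b H b≤i = subst (_≤ℚ H i) (sym (QP.+-identityˡ _)) (restrict-≤ c d i)

  mass-nonNeg : ∀ a b → 0ℚ ≤ℚ mass a b
  mass-nonNeg a b = ∑-nonNeg n (λ i _ → restrict-nonNeg a b H 0≤H i)

  mass-merge : ∀ a b c → a ≤ b → b ≤ c → mass a b +ℚ mass b c ≡ mass a c
  mass-merge a b c a≤b b≤c =
    trans (sym (∑-distrib-+ n (restrict a b H) (restrict b c H))) (∑-cong n (λ i _ → restrict-merge a b c i a≤b b≤c))

  mass-whole : mass 0 n ≡ total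
  mass-whole = ∑-cong n (λ i i<n → restrict-inside 0 n H z≤n i<n)

  mass-split : ∀ b → b ≤ n → mass 0 b +ℚ mass b n ≡ total
  mass-split b b≤n = trans (mass-merge 0 b n z≤n b≤n) mass-whole

  mass-overlap : ∀ a b → a ≤ b → b ≤ n → mass 0 b +ℚ mass a n ≡ total +ℚ mass a b
  mass-overlap a b a≤b b≤n = begin
    mass 0 b +ℚ mass a n                ≡⟨ cong (_+ℚ mass a n) (sym (mass-merge 0 a b z≤n a≤b)) ⟩
    (mass 0 a +ℚ mass a b) +ℚ mass a n  ≡⟨ +-swapʳ (mass 0 a) (mass a b) (mass a n) ⟩
    (mass 0 a +ℚ mass a n) +ℚ mass a b  ≡⟨ cong (_+ℚ mass a b) (mass-split a (NP.≤-trans a≤b b≤n)) ⟩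
    total +ℚ mass a b                   ∎
    where open ≡-Reasoning

  mass-≤-total : ∀ a b → mass a b ≤ℚ total
  mass-≤-total a b = ∑-mono-≤ n (λ i _ → restrict-≤ a b i)

  mass-disjoint : ∀ a b c d → b ≤ c → mass a b +ℚ mass c d ≤ℚ total
  mass-disjoint a b c d b≤c = QP.≤-trans (QP.≤-reflexive (sym (∑-distrib-+ n (restrict a b H) (restrict c d H))))
                                          (∑-mono-≤ n (λ i _ → restrict-disjoint a b c d i b≤c))

  weightRℕ≤mass : ∀ k x y a b → (∀ i → i < n → sameDistK k x y i ≡ false → a ≤ i × i < b) →
                  weightRℕ k H x y n ≤ℚ mass a b
  weightRℕ≤mass k x y a b resolvers-inside =
    weightRℕ-≤ k H x y n (restrict a b H) (λ i _ → restrict-nonNeg a b H 0≤H i)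
      (λ i i<n resolved → QP.≤-reflexive (sym (uncurry (restrict-inside a b H) (resolvers-inside i i<n resolved))))

module Windows (k n : ℕ) (H : ℕ → ℚ) (0≤H : ∀ i → 0ℚ ≤ℚ H i)
               (resolves : ∀ x y → x < n → y < n → x ≢ y → 1ℚ ≤ℚ weightRℕ k H x y n) where

  open IntervalMass n H 0≤H public

  M : ℕ
  M = 2 + 2 * k

  -- The pair (x, x+1) is resolved only inside [x ∸ k, x + k + 2).
  adjacent≥1 : ∀ a b x → suc x < n → a ≤ x ∸ k → n ⊓ (2 + x + k) ≤ b → 1ℚ ≤ℚ mass a b
  adjacent≥1 a b x x+1<n a≤x∸k n⊓≤b =
    QP.≤-trans (resolves x (suc x) (NP.<-trans (NP.n<1+n x) x+1<n) x+1<n (NP.<⇒≢ (NP.n<1+n x)))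
               (weightRℕ≤mass k x (suc x) a b nearby)
    where
    nearby : ∀ i → i < n → sameDistK k x (suc x) i ≡ false → a ≤ i × i < b
    nearby i i<n resolved with adjacent-resolver k x i resolved
    ... | x≤i+k , i≤x+k+1 =
      NP.≤-trans a≤x∸k (NP.m≤n+o⇒m∸n≤o x k (subst (x ≤_) (NP.+-comm i k) x≤i+k)) ,
      NP.<-≤-trans (NP.⊓-glb i<n (s≤s i≤x+k+1)) n⊓≤b

  window≥1 : ∀ a → a + M ≤ n → 1ℚ ≤ℚ mass a (a + M)
  window≥1 a a+M≤n = adjacent≥1 a (a + M) (a + k) (NP.<-≤-trans x+1<a+M a+M≤n)
                               (NP.≤-reflexive (sym (NP.m+n∸n≡m a k))) (NP.≤-trans (NP.m⊓n≤n n _) x+k+2≤a+M)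
    where
    x+1<a+M : suc (a + k) < a + M
    x+1<a+M = <-by-+ k (suc (suc (a + k) + k) ≡ a + (2 + 2 * k) ∋ solve (a ∷ k ∷ []))
    x+k+2≤a+M : 2 + (a + k) + k ≤ a + M
    x+k+2≤a+M = ≤-by-+ 0 (2 + (a + k) + k + 0 ≡ a + (2 + 2 * k) ∋ solve (a ∷ k ∷ []))

  firstWindow≥1 : 1 < n → 1ℚ ≤ℚ mass 0 (2 + k)
  firstWindow≥1 1<n = adjacent≥1 0 (2 + k) 0 1<n z≤n (NP.m⊓n≤n n _)

  lastWindow≥1 : ∀ a → a + (2 + k) ≡ n → 1ℚ ≤ℚ mass a n
  lastWindow≥1 a a+k+2≡n = adjacent≥1 a n (a + k) x+1<n (NP.≤-reflexive (sym (NP.m+n∸n≡m a k))) (NP.m⊓n≤m n _)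
    where
    x+1<n : suc (a + k) < n
    x+1<n = <-by-+ 0 (trans (suc (suc (a + k) + 0) ≡ a + (2 + k) ∋ solve (a ∷ k ∷ [])) a+k+2≡n)

  tiles≥ : ∀ j a → a + j * M ≤ n → (+ j) /ℚ 1 ≤ℚ mass a (a + j * M)
  tiles≥ zero    a _  = mass-nonNeg a (a + 0)
  tiles≥ (suc j) a le = begin
    (+ suc j) /ℚ 1                          ≡⟨ sym (1+j/1 j) ⟩
    1ℚ +ℚ (+ j) /ℚ 1                        ≤⟨ QP.+-mono-≤ (window≥1 a a+M≤n) (tiles≥ j (a + M) rest≤n) ⟩
    mass a (a + M) +ℚ mass (a + M) (a + M + j * M)
                                            ≡⟨ mass-merge a (a + M) _ (NP.m≤m+n a M) (NP.m≤m+n _ _) ⟩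
    mass a (a + M + j * M)                  ≡⟨ cong (mass a) (NP.+-assoc a M (j * M)) ⟩
    mass a (a + suc j * M)                  ∎
    where
    open QP.≤-Reasoning
    rest≤n : a + M + j * M ≤ n
    rest≤n = subst (_≤ n) (sym (NP.+-assoc a M (j * M))) le
    a+M≤n : a + M ≤ n
    a+M≤n = NP.≤-trans (NP.m≤m+n _ _) rest≤n

  leftTiles≥ : ∀ j → 2 + k + j * M ≤ n → (+ suc j) /ℚ 1 ≤ℚ mass 0 (2 + k + j * M)
  leftTiles≥ j le = begin
    (+ suc j) /ℚ 1                                  ≡⟨ sym (1+j/1 j) ⟩
    1ℚ +ℚ (+ j) /ℚ 1                                ≤⟨ QP.+-mono-≤ (firstWindow≥1 1<n) (tiles≥ j (2 + k) le) ⟩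
    mass 0 (2 + k) +ℚ mass (2 + k) (2 + k + j * M)  ≡⟨ mass-merge 0 (2 + k) _ z≤n (NP.m≤m+n _ _) ⟩
    mass 0 (2 + k + j * M)                          ∎
    where
    open QP.≤-Reasoning
    1<n : 1 < n
    1<n = NP.<-≤-trans (s≤s (s≤s z≤n)) (NP.≤-trans (NP.m≤m+n 2 (k + j * M)) (subst (_≤ n) (NP.+-assoc 2 k (j * M)) le))

  rightTiles≥ : ∀ j a → a + j * M + (2 + k) ≡ n → (+ suc j) /ℚ 1 ≤ℚ mass a n
  rightTiles≥ j a eq = begin
    (+ suc j) /ℚ 1                          ≡⟨ sym (trans (QP.+-comm ((+ j) /ℚ 1) 1ℚ) (1+j/1 j)) ⟩
    (+ j) /ℚ 1 +ℚ 1ℚ                        ≤⟨ QP.+-mono-≤ (tiles≥ j a tiles≤n) (lastWindow≥1 (a + j * M) eq) ⟩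
    mass a (a + j * M) +ℚ mass (a + j * M) n ≡⟨ mass-merge a (a + j * M) n (NP.m≤m+n _ _) tiles≤n ⟩
    mass a n                                ∎
    where
    open QP.≤-Reasoning
    tiles≤n : a + j * M ≤ n
    tiles≤n = ≤-by-+ (2 + k) eq

  endPair≥1 : ∀ b c → 0 < c → suc c ≡ n → b + suc k ≡ n → 1ℚ ≤ℚ mass 0 (suc k) +ℚ mass b n
  endPair≥1 b c 0<c c+1≡n b+k+1≡n =
    QP.≤-trans (resolves 0 c (NP.<-trans 0<c c<n) c<n (NP.<⇒≢ 0<c))
      (QP.≤-trans (weightRℕ-≤ k H 0 c n (λ i → restrict 0 (suc k) H i +ℚ restrict b n H i) 0≤ends covered)
        (QP.≤-reflexive (∑-distrib-+ n _ _)))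
    where
    c<n : c < n
    c<n = NP.≤-reflexive c+1≡n
    0≤ends : ∀ i → i < n → 0ℚ ≤ℚ restrict 0 (suc k) H i +ℚ restrict b n H i
    0≤ends i _ = QP.+-mono-≤ (restrict-nonNeg 0 (suc k) H 0≤H i) (restrict-nonNeg b n H 0≤H i)
    near-end : ∀ {i} → ∣ c - i ∣ ≤ k → b ≤ i
    near-end {i} close = NP.+-cancelʳ-≤ (suc k) b i (≤-cong (s≤s (∣x-i∣≤k⇒x≤i+k close))
                           (trans c+1≡n (sym b+k+1≡n)) (sym (NP.+-suc i k)))
    covered : ∀ i → i < n → sameDistK k 0 c i ≡ false → H i ≤ℚ restrict 0 (suc k) H i +ℚ restrict b n H i
    covered i i<n resolved with resolver-close k 0 c i resolved
    ... | inj₁ close = QP.≤-trans (p≤p+q (restrict-nonNeg b n H 0≤H i)) (QP.≤-reflexive (cong (_+ℚ restrict b n H i)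
                         (sym (restrict-inside 0 (suc k) H z≤n (s≤s (∣x-i∣≤k⇒i≤x+k close))))))
    ... | inj₂ close = QP.≤-trans (p≤q+p (restrict-nonNeg 0 (suc k) H 0≤H i)) (QP.≤-reflexive (cong (restrict 0 (suc k) H i +ℚ_)
                         (sym (restrict-inside b n H (near-end close) i<n))))

  -- The middle vertex u+1 does not resolve the pair (u, u+2).
  middlePair : ∀ u → suc (suc u) < n → 1ℚ +ℚ H (suc u) ≤ℚ total
  middlePair u u+2<n = begin
    1ℚ +ℚ H (suc u)                                                   ≤⟨ QP.+-monoˡ-≤ (H (suc u)) (resolves u (suc (suc u)) u<n u+2<n (NP.<⇒≢ u<u+2)) ⟩
    weightRℕ k H u (suc (suc u)) n +ℚ H (suc u)                      ≡⟨ cong (weightRℕ k H u (suc (suc u)) n +ℚ_) (sym (∑-point n (suc u) (H (suc u)) u+1<n)) ⟩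
    weightRℕ k H u (suc (suc u)) n +ℚ ∑ (point (suc u) (H (suc u))) n ≡⟨ sym (∑-distrib-+ n _ _) ⟩
    ∑ (λ i → (if sameDistK k u (suc (suc u)) i then 0ℚ else H i) +ℚ point (suc u) (H (suc u)) i) n
                                                                      ≤⟨ ∑-mono-≤ n (λ i _ → pointwise i) ⟩
    total                                                             ∎
    where
    open QP.≤-Reasoning
    u+1<n : suc u < n
    u+1<n = NP.<-trans (NP.n<1+n _) u+2<n
    u<n : u < n
    u<n = NP.<-trans (NP.n<1+n u) u+1<n
    u<u+2 : u < suc (suc u)
    u<u+2 = NP.<-trans (NP.n<1+n u) (NP.n<1+n _)
    equidistant : ∣ u - suc u ∣ ≡ ∣ suc (suc u) - suc u ∣
    equidistant = NP.∣-∣-comm (suc u) (suc (suc u))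
    pointwise : ∀ i → (if sameDistK k u (suc (suc u)) i then 0ℚ else H i) +ℚ point (suc u) (H (suc u)) i ≤ℚ H i
    pointwise i with i ℕ.≟ suc u
    ... | yes refl rewrite equidistant-unresolved k u (suc (suc u)) (suc u) equidistant = QP.≤-reflexive (QP.+-identityˡ _)
    ... | no  _ with sameDistK k u (suc (suc u)) i
    ...   | true  = QP.≤-trans (QP.≤-reflexive (QP.+-identityˡ 0ℚ)) (0≤H i)
    ...   | false = QP.≤-reflexive (QP.+-identityʳ (H i))

-- Upper bound from the multiples of k+1

halfIfZero : ℕ → ℚ
halfIfZero zero    = ½
halfIfZero (suc _) = 0ℚ

halfMultiples : ℕ → ℕ → ℚ
halfMultiples k i = halfIfZero (i % suc k)

marks : ℕ → ℕ → ℕ → ℚ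
marks k n i with i ℕ.≟ n ∸ 1
... | yes _ = ½
... | no  _ = halfMultiples k i

0≤halfIfZero : ∀ r → 0ℚ ≤ℚ halfIfZero r
0≤halfIfZero zero    = 0≤½
0≤halfIfZero (suc _) = QP.≤-refl

halfIfZero≤1 : ∀ r → halfIfZero r ≤ℚ 1ℚ
halfIfZero≤1 zero    = ½≤1
halfIfZero≤1 (suc _) = 0≤1

marks-nonNeg : ∀ k n i → 0ℚ ≤ℚ marks k n i
marks-nonNeg k n i with i ℕ.≟ n ∸ 1
... | yes _ = 0≤½
... | no  _ = 0≤halfIfZero (i % suc k)

marks-≤1 : ∀ k n i → marks k n i ≤ℚ 1ℚ
marks-≤1 k n i with i ℕ.≟ n ∸ 1
... | yes _ = ½≤1
... | no  _ = halfIfZero≤1 (i % suc k)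

marks-multiple : ∀ k n i → i % suc k ≡ 0 → marks k n i ≡ ½
marks-multiple k n i i%≡0 with i ℕ.≟ n ∸ 1
... | yes _ = refl
... | no  _ = cong halfIfZero i%≡0

marks-last : ∀ k n → marks k n (n ∸ 1) ≡ ½
marks-last k n with n ∸ 1 ℕ.≟ n ∸ 1
... | yes _   = refl
... | no  ≢-refl = contradiction refl ≢-refl

multiple-below : ∀ k x → Σ[ a ∈ ℕ ] a % suc k ≡ 0 × a ≤ x × x ∸ a ≤ k
multiple-below k x = (x / suc k) * suc k , DM.m*n%n≡0 (x / suc k) (suc k) , DM.m/n*n≤m x (suc k) ,
  NP.≤-pred (subst (_< suc k) (DM.m%n≡m∸m/n*n x (suc k)) (DM.m%n<n x (suc k)))

multiple-above : ∀ k y → Σ[ s ∈ ℕ ] s % suc k ≡ 0 × y ≤ s × s ≤ y + k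
multiple-above k y = s , DM.m*n%n≡0 ((y + k) / suc k) (suc k) , y≤s , s≤y+k
  where
  s = ((y + k) / suc k) * suc k
  s≤y+k : s ≤ y + k
  s≤y+k = DM.m/n*n≤m (y + k) (suc k)
  y+k∸s≤k : y + k ∸ s ≤ k
  y+k∸s≤k = NP.≤-pred (subst (_< suc k) (DM.m%n≡m∸m/n*n (y + k) (suc k)) (DM.m%n<n (y + k) (suc k)))
  y≤s : y ≤ s
  y≤s = NP.+-cancelʳ-≤ k y s (NP.≤-trans (NP.m≤n+m∸n (y + k) s) (NP.+-monoʳ-≤ s y+k∸s≤k))

two-halves-resolve : ∀ k H x y n a s → a < s → s < n → sameDistK k x y a ≡ false → sameDistK k x y s ≡ false →
                     H a ≡ ½ → H s ≡ ½ → (∀ i → 0ℚ ≤ℚ H i) → 1ℚ ≤ℚ weightRℕ k H x y n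
two-halves-resolve k H x y n a s a<s s<n a-resolves s-resolves Ha≡½ Hs≡½ 0≤H =
  QP.≤-trans (QP.≤-reflexive 1≡∑G) (weightRℕ-≥ k H x y n G G≤0 G≤H)
  where
  G : ℕ → ℚ
  G i = point a ½ i +ℚ point s ½ i
  1≡∑G : 1ℚ ≡ ∑ G n
  1≡∑G = sym (trans (∑-distrib-+ n _ _) (cong₂ _+ℚ_ (∑-point n a ½ (NP.<-trans a<s s<n)) (∑-point n s ½ s<n)))
  G≤0 : ∀ i → i < n → sameDistK k x y i ≡ true → G i ≤ℚ 0ℚ
  G≤0 i _ unresolved with i ℕ.≟ a | i ℕ.≟ s
  ... | yes refl | _        = contradiction (trans (sym unresolved) a-resolves) (λ ())
  ... | no  _    | yes refl = contradiction (trans (sym unresolved) s-resolves) (λ ())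
  ... | no  _    | no  _    = QP.≤-reflexive (QP.+-identityˡ 0ℚ)
  G≤H : ∀ i → i < n → sameDistK k x y i ≡ false → G i ≤ℚ H i
  G≤H i _ _ with i ℕ.≟ a | i ℕ.≟ s
  ... | yes refl | yes refl = contradiction a<s (NP.<-irrefl refl)
  ... | yes refl | no  _    = QP.≤-reflexive (trans (QP.+-identityʳ ½) (sym Ha≡½))
  ... | no  _    | yes refl = QP.≤-reflexive (trans (QP.+-identityˡ ½) (sym Hs≡½))
  ... | no  _    | no  _    = QP.≤-trans (QP.≤-reflexive (QP.+-identityˡ 0ℚ)) (0≤H i)

-- x is resolved by the multiple of k+1 just below it, and y by the one just above it,
-- or by n−1 if that multiple is not below n−1.
marks-resolves : ∀ k n x y → x < y → y < n → 1ℚ ≤ℚ weightRℕ k (marks k n) x y n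
marks-resolves k n x y x<y y<n with multiple-below k x | y + k ℕ.<? n ∸ 1
... | a , a%≡0 , a≤x , x∸a≤k | yes y+k<n-1 with multiple-above k y
...   | s , s%≡0 , y≤s , s≤y+k =
  two-halves-resolve k (marks k n) x y n a s (NP.≤-<-trans a≤x (NP.<-≤-trans x<y y≤s))
    (NP.≤-<-trans s≤y+k (NP.<-≤-trans y+k<n-1 (NP.m∸n≤m n 1)))
    (resolves-from-below k a≤x x<y x∸a≤k) (resolves-from-above k x<y y≤s (NP.m≤n+o⇒m∸n≤o s y s≤y+k))
    (marks-multiple k n a a%≡0) (marks-multiple k n s s%≡0) (marks-nonNeg k n)
marks-resolves k n x y x<y y<n | a , a%≡0 , a≤x , x∸a≤k | no y+k≮n-1 =
  two-halves-resolve k (marks k n) x y n a (n ∸ 1) (NP.≤-<-trans a≤x (NP.<-≤-trans x<y y≤n-1)) n-1<n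
    (resolves-from-below k a≤x x<y x∸a≤k) (resolves-from-above k x<y y≤n-1 (NP.m≤n+o⇒m∸n≤o (n ∸ 1) y (NP.≮⇒≥ y+k≮n-1)))
    (marks-multiple k n a a%≡0) (marks-last k n) (marks-nonNeg k n)
  where
  y≤n-1 : y ≤ n ∸ 1
  y≤n-1 = NP.m+n≤o⇒m≤o∸n y (subst (_≤ n) (NP.+-comm 1 y) y<n)
  n-1<n : n ∸ 1 < n
  n-1<n = NP.∸-monoʳ-< {n} {1} {0} (s≤s z≤n) (NP.<-≤-trans (s≤s z≤n) y<n)

∑-halfMultiples-initial : ∀ k t → t ≤ k → ∑ (halfMultiples k) (suc t) ≡ ½
∑-halfMultiples-initial k t t≤k = begin
  ∑ (halfMultiples k) (suc t) ≡⟨ ∑-cong (suc t) (λ i i≤t → cong halfIfZero (DM.m≤n⇒m%n≡m (NP.≤-trans (NP.≤-pred i≤t) t≤k))) ⟩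
  ∑ halfIfZero (suc t)        ≡⟨ cong (½ +ℚ_) (∑-zero t (λ _ _ → refl)) ⟩
  ½ +ℚ 0ℚ                     ≡⟨ QP.+-identityʳ ½ ⟩
  ½                           ∎
  where open ≡-Reasoning

halfMultiples-periodic : ∀ k j i → halfMultiples k (j * suc k + i) ≡ halfMultiples k i
halfMultiples-periodic k j i =
  cong halfIfZero (trans (cong (_% suc k) (NP.+-comm (j * suc k) i)) (DM.[m+kn]%n≡m%n i j (suc k)))

∑-halfMultiples-blocks : ∀ k j → ∑ (halfMultiples k) (j * suc k) ≡ (+ j) /ℚ 2
∑-halfMultiples-blocks k zero    = refl
∑-halfMultiples-blocks k (suc j) = begin
  ∑ (halfMultiples k) (suc k + j * suc k)                                      ≡⟨ ∑-split (suc k) (j * suc k) (halfMultiples k) ⟩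
  ∑ (halfMultiples k) (suc k) +ℚ ∑ (λ i → halfMultiples k (suc k + i)) (j * suc k)
    ≡⟨ cong₂ _+ℚ_ (∑-halfMultiples-initial k k NP.≤-refl)
                  (∑-cong (j * suc k) (λ i _ → trans (cong (λ m → halfMultiples k (m + i)) (sym (NP.*-identityˡ (suc k))))
                                                    (halfMultiples-periodic k 1 i))) ⟩
  ½ +ℚ ∑ (halfMultiples k) (j * suc k)                                        ≡⟨ cong (½ +ℚ_) (∑-halfMultiples-blocks k j) ⟩
  ½ +ℚ (+ j) /ℚ 2                                                              ≡⟨ /-distrib-+ (+ 1) (+ j) 1 ⟩
  (+ suc j) /ℚ 2                                                               ∎
  where open ≡-Reasoning

-- The extra weight that the last vertex j(k+1)+t gets on top of halfMultiples.
lastBonus : ℕ → ℚ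
lastBonus zero    = 0ℚ
lastBonus (suc _) = ½

∑-marks : ∀ k j t → t ≤ k → ∑ (marks k (suc (j * suc k + t))) (suc (j * suc k + t)) ≡ ((+ j) /ℚ 2 +ℚ ½) +ℚ lastBonus t
∑-marks k j t t≤k = begin
  ∑ (marks k n) n                                              ≡⟨ ∑-cong n (λ i _ → marks≡ i) ⟩
  ∑ (λ i → halfMultiples k i +ℚ point N (lastBonus t) i) n     ≡⟨ ∑-distrib-+ n (halfMultiples k) (point N (lastBonus t)) ⟩
  ∑ (halfMultiples k) n +ℚ ∑ (point N (lastBonus t)) n          ≡⟨ cong₂ _+ℚ_ halves (∑-point n N (lastBonus t) (NP.n<1+n N)) ⟩
  ((+ j) /ℚ 2 +ℚ ½) +ℚ lastBonus t                             ∎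
  where
  open ≡-Reasoning
  N = j * suc k + t
  n = suc N
  N%≡t : N % suc k ≡ t
  N%≡t = trans (cong (_% suc k) (NP.+-comm (j * suc k) t)) (trans (DM.[m+kn]%n≡m%n t j (suc k)) (DM.m≤n⇒m%n≡m t≤k))
  halves : ∑ (halfMultiples k) n ≡ (+ j) /ℚ 2 +ℚ ½
  halves = trans (cong (∑ (halfMultiples k)) (sym (NP.+-suc (j * suc k) t)))
             (trans (∑-split (j * suc k) (suc t) (halfMultiples k))
               (cong₂ _+ℚ_ (∑-halfMultiples-blocks k j)
                 (trans (∑-cong (suc t) (λ i _ → halfMultiples-periodic k j i)) (∑-halfMultiples-initial k t t≤k))))
  halfIfZero+lastBonus : ∀ r → ½ ≡ halfIfZero r +ℚ lastBonus r
  halfIfZero+lastBonus zero    = sym (QP.+-identityʳ ½)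
  halfIfZero+lastBonus (suc _) = sym (QP.+-identityˡ ½)
  marks≡ : ∀ i → marks k n i ≡ halfMultiples k i +ℚ point N (lastBonus t) i
  marks≡ i with i ℕ.≟ N
  ... | yes refl = trans (halfIfZero+lastBonus t) (cong (λ r → halfIfZero r +ℚ lastBonus t) (sym N%≡t))
  ... | no  _    = sym (QP.+-identityʳ _)

marksFin : ℕ → (n : ℕ) → Fin n → ℚ
marksFin k n z = marks k n (toℕ z)

marks-resolving : ∀ k n → IsResolving k n (marksFin k n)
marks-resolving k n = resolving-fromℕ k n (marks k n) (marks-nonNeg k n) (marks-≤1 k n) (marks-resolves k n)

sumFin-marks : ∀ k n j t → t ≤ k → suc (j * suc k + t) ≡ n → sumFin n (marksFin k n) ≡ ((+ j) /ℚ 2 +ℚ ½) +ℚ lastBonus t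
sumFin-marks k n j t t≤k refl = trans (sumFin≡∑ n (marks k n)) (∑-marks k j t t≤k)

LowerBound : ℕ → ℕ → ℚ → Set
LowerBound k n v = ∀ H (0≤H : ∀ i → 0ℚ ≤ℚ H i) →
                   (∀ x y → x < n → y < n → x ≢ y → 1ℚ ≤ℚ weightRℕ k H x y n) → v ≤ℚ ∑ H n

LowerBound⇒≤sumFin : ∀ {k n v} → LowerBound k n v → (h : Fin n → ℚ) → IsResolving k n h → v ≤ℚ sumFin n h
LowerBound⇒≤sumFin {k} {n} bound h R =
  subst (_ ≤ℚ_) (sym (sumFin≡∑-extend n h)) (bound (extend h) (extend-nonNeg h R) (resolving⇒weightRℕ≥1 h R))

-- Short paths

fracDim-short : ∀ k n → 2 ≤ n → n ≤ k + 2 → FracDimIs k n 1ℚ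
fracDim-short k n 2≤n n≤k+2 = ((λ z → H (toℕ z)) , resolving-fromℕ k n H 0≤H H≤1 resolves , ∑H≡1) ,
                              LowerBound⇒≤sumFin atLeastOne
  where
  H = point 0 1ℚ
  0<n : 0 < n
  0<n = NP.<-trans (s≤s z≤n) 2≤n
  ∑H≡1 : sumFin n (λ z → H (toℕ z)) ≡ 1ℚ
  ∑H≡1 = trans (sumFin≡∑ n H) (∑-point n 0 1ℚ 0<n)
  0≤H : ∀ i → 0ℚ ≤ℚ H i
  0≤H = point-nonNeg 0 0≤1
  H≤1 : ∀ i → H i ≤ℚ 1ℚ
  H≤1 i with i ℕ.≟ 0
  ... | yes _ = QP.≤-refl
  ... | no  _ = 0≤1
  -- Vertex 0 is at distance x ≤ k from the nearer vertex of every pair x < y.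
  resolves : ∀ x y → x < y → y < n → 1ℚ ≤ℚ weightRℕ k H x y n
  resolves x y x<y y<n = QP.≤-trans (QP.≤-reflexive (sym (∑-point n 0 1ℚ 0<n))) (weightRℕ-≥ k H x y n H H≤0 (λ _ _ _ → QP.≤-refl))
    where
    x≤k : x ≤ k
    x≤k = NP.≤-pred (NP.≤-pred (subst (suc (suc x) ≤_) (NP.+-comm k 2) (NP.≤-trans (s≤s x<y) (NP.≤-trans y<n n≤k+2))))
    0-resolves : sameDistK k x y 0 ≡ false
    0-resolves = nearer-x-resolves k x y 0 (subst (_≤ k) (sym (NP.∣-∣-identityʳ x)) x≤k)
                   (subst₂ _<_ (sym (NP.∣-∣-identityʳ x)) (sym (NP.∣-∣-identityʳ y)) x<y)
    H≤0 : ∀ i → i < n → sameDistK k x y i ≡ true → H i ≤ℚ 0ℚ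
    H≤0 i _ unresolved with i ℕ.≟ 0
    ... | yes refl = contradiction (trans (sym unresolved) 0-resolves) (λ ())
    ... | no  _    = QP.≤-refl
  atLeastOne : LowerBound k n 1ℚ
  atLeastOne H 0≤H resolves =
    QP.≤-trans (resolves 0 1 0<n 2≤n (λ ())) (weightRℕ≤∑ k H 0 1 n 0≤H)

-- Long paths

ceiling-lower-bound : ∀ k n q a → 2 + k + q * (2 + 2 * k) ≤ a → a + (2 + k) ≡ n → LowerBound k n ((+ suc (suc q)) /ℚ 1)
ceiling-lower-bound k n q a tiles≤a a+k+2≡n H 0≤H resolves = begin
  (+ suc (suc q)) /ℚ 1                                 ≡⟨ sym (trans (QP.+-comm ((+ suc q) /ℚ 1) 1ℚ) (1+j/1 (suc q))) ⟩
  (+ suc q) /ℚ 1 +ℚ 1ℚ                                 ≤⟨ QP.+-mono-≤ (leftTiles≥ q (NP.≤-trans tiles≤a (≤-by-+ (2 + k) a+k+2≡n)))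
                                                                      (lastWindow≥1 a a+k+2≡n) ⟩
  mass 0 (2 + k + q * (2 + 2 * k)) +ℚ mass a n         ≤⟨ mass-disjoint 0 _ a n tiles≤a ⟩
  total                                                ∎
  where
  open Windows k n H 0≤H resolves
  open QP.≤-Reasoning

twoTilings≥ : ∀ k n q → suc (2 + 2 * k + q * (2 + 2 * k)) ≡ n → LowerBound k n ((+ (3 + 2 * q)) /ℚ 2)
twoTilings≥ k n q n≡ H 0≤H resolves = a/1≤d*S⇒a/d≤S (+ (3 + 2 * q)) 1 total (begin
  (+ (3 + 2 * q)) /ℚ 1                                  ≡⟨ sym 3+2q≡ ⟩
  ((+ suc q) /ℚ 1 +ℚ (+ suc q) /ℚ 1) +ℚ 1ℚ              ≤⟨ QP.+-mono-≤ (QP.+-mono-≤ left right) ends ⟩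
  (mass 0 b +ℚ mass (suc k) n) +ℚ (mass 0 (suc k) +ℚ mass b n)
                                                        ≡⟨ regroup (mass 0 b) (mass (suc k) n) (mass 0 (suc k)) (mass b n) ⟩
  (mass 0 b +ℚ mass b n) +ℚ (mass 0 (suc k) +ℚ mass (suc k) n)
                                                        ≡⟨ cong₂ _+ℚ_ (mass-split b b≤n) (mass-split (suc k) k+1≤n) ⟩
  total +ℚ total                                        ≡⟨ cong (total +ℚ_) (sym (QP.+-identityʳ total)) ⟩
  total +ℚ (total +ℚ 0ℚ)                                ≡⟨ ∑-const 2 total ⟩
  ((+ 2) /ℚ 1) *ℚ total                                 ∎)
  where
  open Windows k n H 0≤H resolves
  open QP.≤-Reasoning
  regroup : ∀ a b c d → (a +ℚ b) +ℚ (c +ℚ d) ≡ (a +ℚ d) +ℚ (c +ℚ b)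
  regroup = QS.solve 4 (λ a b c d → (a QS.:+ b) QS.:+ (c QS.:+ d) QS.:= (a QS.:+ d) QS.:+ (c QS.:+ b)) refl
    where module QS = +-*-Solver
  b = 2 + k + q * M
  b+k+1≡n : b + suc k ≡ n
  b+k+1≡n = trans (2 + k + q * (2 + 2 * k) + suc k ≡ suc (2 + 2 * k + q * (2 + 2 * k)) ∋ solve (q ∷ k ∷ [])) n≡
  b≤n : b ≤ n
  b≤n = ≤-by-+ (suc k) b+k+1≡n
  k+1≤n : suc k ≤ n
  k+1≤n = ≤-by-+ b (trans (NP.+-comm (suc k) b) b+k+1≡n)
  left : (+ suc q) /ℚ 1 ≤ℚ mass 0 b
  left = leftTiles≥ q b≤n
  right : (+ suc q) /ℚ 1 ≤ℚ mass (suc k) n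
  right = rightTiles≥ q (suc k) (trans (suc k + q * (2 + 2 * k) + (2 + k) ≡ suc (2 + 2 * k + q * (2 + 2 * k)) ∋ solve (q ∷ k ∷ [])) n≡)
  ends : 1ℚ ≤ℚ mass 0 (suc k) +ℚ mass b n
  ends = endPair≥1 b (2 + 2 * k + q * M) (s≤s z≤n) n≡ b+k+1≡n
  3+2q≡ : ((+ suc q) /ℚ 1 +ℚ (+ suc q) /ℚ 1) +ℚ 1ℚ ≡ (+ (3 + 2 * q)) /ℚ 1
  3+2q≡ = trans (cong (_+ℚ 1ℚ) (/-distrib-+ (+ suc q) (+ suc q) 0))
            (trans (/-distrib-+ (+ (suc q + suc q)) (+ 1) 0) (cong (λ m → (+ m) /ℚ 1) (suc q + suc q + 1 ≡ 3 + 2 * q ∋ solve (q ∷ []))))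

j/2+½ : ∀ j → (+ j) /ℚ 2 +ℚ ½ ≡ (+ suc j) /ℚ 2
j/2+½ j = trans (QP.+-comm ((+ j) /ℚ 2) ½) (/-distrib-+ (+ 1) (+ j) 1)

j/2+½+½ : ∀ j → ((+ j) /ℚ 2 +ℚ ½) +ℚ ½ ≡ (+ suc (suc j)) /ℚ 2
j/2+½+½ j = trans (cong (_+ℚ ½) (j/2+½ j)) (j/2+½ (suc j))

[c+c]/2≡c/1 : ∀ c → (+ (c + c)) /ℚ 2 ≡ (+ c) /ℚ 1
[c+c]/2≡c/1 c = /-≡-crossℕ (c + c) c 1 0 ((c + c) * 1 ≡ c * 2 ∋ solve (c ∷ []))

[1+c+c]/2≡c/1+½ : ∀ c → (+ suc (c + c)) /ℚ 2 ≡ (+ c) /ℚ 1 +ℚ ½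
[1+c+c]/2≡c/1+½ c = trans (sym (j/2+½ (c + c))) (cong (_+ℚ ½) ([c+c]/2≡c/1 c))

marks-total-last : ∀ j c → suc j ≡ c + c → ((+ j) /ℚ 2 +ℚ ½) +ℚ lastBonus 0 ≡ (+ c) /ℚ 1
marks-total-last j c eq =
  trans (trans (QP.+-identityʳ _) (j/2+½ j)) (trans (cong (λ m → (+ m) /ℚ 2) eq) ([c+c]/2≡c/1 c))

marks-total-extra : ∀ j t c → suc (suc j) ≡ c + c → ((+ j) /ℚ 2 +ℚ ½) +ℚ lastBonus (suc t) ≡ (+ c) /ℚ 1
marks-total-extra j t c eq = trans (j/2+½+½ j) (trans (cong (λ m → (+ m) /ℚ 2) eq) ([c+c]/2≡c/1 c))

marks-total-half : ∀ j t c → suc j ≡ c + c → ((+ j) /ℚ 2 +ℚ ½) +ℚ lastBonus (suc t) ≡ (+ c) /ℚ 1 +ℚ ½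
marks-total-half j t c eq = trans (j/2+½+½ j) (trans (cong (λ m → (+ suc m) /ℚ 2) eq) ([1+c+c]/2≡c/1+½ c))

long-quotient : ∀ k n → 2 * k + 4 ≤ n → Σ[ q ∈ ℕ ] n ≡ n % (2 + 2 * k) + suc q * (2 + 2 * k)
long-quotient k n 2k+4≤n with n / (2 + 2 * k) | DM.m≥n⇒m/n>0 {n} {2 + 2 * k} M≤n | DM.m≡m%n+[m/n]*n n (2 + 2 * k)
  where
  M≤n : 2 + 2 * k ≤ n
  M≤n = NP.≤-trans (≤-by-+ 2 (2 + 2 * k + 2 ≡ 2 * k + 4 ∋ solve (k ∷ []))) 2k+4≤n
... | suc q | _ | n≡ = q , n≡

fracDim-mod≡1 : ∀ k n q → n ≡ 1 + suc q * (2 + 2 * k) → FracDimIs k n ((+ (n + k)) /ℚ (2 + 2 * k))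
fracDim-mod≡1 k n q refl = subst (FracDimIs k n) value≡
  ((marksFin k n , marks-resolving k n , total≡) , LowerBound⇒≤sumFin (twoTilings≥ k n q n≡))
  where
  n≡ : suc (2 + 2 * k + q * (2 + 2 * k)) ≡ 1 + suc q * (2 + 2 * k)
  n≡ = solve (q ∷ k ∷ [])
  total≡ : sumFin n (marksFin k n) ≡ (+ (3 + 2 * q)) /ℚ 2
  total≡ = trans (sumFin-marks k n (2 * suc q) 0 z≤n (suc (2 * suc q * suc k + 0) ≡ 1 + suc q * (2 + 2 * k) ∋ solve (q ∷ k ∷ [])))
             (trans (trans (QP.+-identityʳ _) (j/2+½ (2 * suc q)))
                    (cong (λ m → (+ m) /ℚ 2) (suc (2 * suc q) ≡ 3 + 2 * q ∋ solve (q ∷ []))))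
  value≡ : (+ (3 + 2 * q)) /ℚ 2 ≡ (+ (n + k)) /ℚ (2 + 2 * k)
  value≡ = /-≡-crossℕ (3 + 2 * q) (n + k) 1 (1 + 2 * k)
             ((3 + 2 * q) * suc (1 + 2 * k) ≡ (1 + suc q * (2 + 2 * k) + k) * 2 ∋ solve (q ∷ k ∷ []))

fracDim-mod≤k+2 : ∀ k n q r → n ≡ 2 + r + suc q * (2 + 2 * k) → r ≤ k → FracDimIs k n (ceilQ k n)
fracDim-mod≤k+2 k n q r refl r≤k = subst (FracDimIs k n) (sym ceil≡)
  ((marksFin k n , marks-resolving k n , total≡) ,
   LowerBound⇒≤sumFin (ceiling-lower-bound k n q (r + k + 2 + q * (2 + 2 * k)) tiles≤a a+k+2≡n))
  where
  tiles≤a : 2 + k + q * (2 + 2 * k) ≤ r + k + 2 + q * (2 + 2 * k)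
  tiles≤a = ≤-by-+ r (2 + k + q * (2 + 2 * k) + r ≡ r + k + 2 + q * (2 + 2 * k) ∋ solve (r ∷ k ∷ q ∷ []))
  a+k+2≡n : r + k + 2 + q * (2 + 2 * k) + (2 + k) ≡ 2 + r + suc q * (2 + 2 * k)
  a+k+2≡n = solve (r ∷ k ∷ q ∷ [])
  ceil≡ : ceilQ k n ≡ (+ suc (suc q)) /ℚ 1
  ceil≡ = ceilQ≡ k n (suc q) (<-by-+ (1 + r) (suc (suc q * (2 + 2 * k) + (1 + r)) ≡ 2 + r + suc q * (2 + 2 * k) ∋ solve (r ∷ k ∷ q ∷ [])))
            (NP.+-monoˡ-≤ (suc q * (2 + 2 * k)) (s≤s (s≤s (NP.≤-trans r≤k (NP.m≤n*m k 2)))))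
  total≡ : sumFin n (marksFin k n) ≡ (+ suc (suc q)) /ℚ 1
  total≡ with r ℕ.<? k
  ... | yes r<k = trans (sumFin-marks k n (2 * suc q) (suc r) r<k
                          (suc (2 * suc q * suc k + suc r) ≡ 2 + r + suc q * (2 + 2 * k) ∋ solve (r ∷ k ∷ q ∷ [])))
                        (marks-total-extra (2 * suc q) r (suc (suc q)) (suc (suc (2 * suc q)) ≡ suc (suc q) + suc (suc q) ∋ solve (q ∷ [])))
  ... | no  r≮k with NP.≤-antisym r≤k (NP.≮⇒≥ r≮k)
  ...   | refl = trans (sumFin-marks k n (suc (2 * suc q)) 0 z≤n
                         (suc (suc (2 * suc q) * suc r + 0) ≡ 2 + r + suc q * (2 + 2 * r) ∋ solve (r ∷ q ∷ [])))
                       (marks-total-last (suc (2 * suc q)) (suc (suc q)) (suc (suc (2 * suc q)) ≡ suc (suc q) + suc (suc q) ∋ solve (q ∷ [])))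

-- Only here is 1 ≤ k needed: the last vertex is then not a multiple of k+1.
fracDim-mod≡0 : ∀ k n q → 1 ≤ k → 2 * k + 4 ≤ n → n ≡ suc q * (2 + 2 * k) →
                FracDimBetween k n (ceilQ k n) (ceilQ k n +ℚ ½)
fracDim-mod≡0 k n zero _ 2k+4≤n refl =
  contradiction 2k+4≤n (NP.<⇒≱ (<-by-+ 1 (suc (1 * (2 + 2 * k) + 1) ≡ 2 * k + 4 ∋ solve (k ∷ []))))
fracDim-mod≡0 k@(suc k′) n (suc q) _ _ refl = subst (λ c → FracDimBetween k n c (c +ℚ ½)) (sym ceil≡)
  (LowerBound⇒≤sumFin tiled , marksFin k n , marks-resolving k n , QP.≤-reflexive total≡)
  where
  ceil≡ : ceilQ k n ≡ (+ suc (suc q)) /ℚ 1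
  ceil≡ = ceilQ≡ k n (suc q) (<-by-+ (1 + 2 * k) (suc (suc q * (2 + 2 * k) + (1 + 2 * k)) ≡ suc (suc q) * (2 + 2 * k) ∋ solve (q ∷ k′ ∷ []))) NP.≤-refl
  total≡ : sumFin n (marksFin k n) ≡ (+ suc (suc q)) /ℚ 1 +ℚ ½
  total≡ = trans (sumFin-marks k n (3 + 2 * q) k NP.≤-refl (suc ((3 + 2 * q) * suc k + k) ≡ suc (suc q) * (2 + 2 * k) ∋ solve (q ∷ k′ ∷ [])))
                 (marks-total-half (3 + 2 * q) k′ (suc (suc q)) (suc (3 + 2 * q) ≡ suc (suc q) + suc (suc q) ∋ solve (q ∷ [])))
  tiled : LowerBound k n ((+ suc (suc q)) /ℚ 1)
  tiled H 0≤H resolves = QP.≤-trans (tiles≥ (suc (suc q)) 0 NP.≤-refl) (mass-≤-total 0 n)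
    where open Windows k n H 0≤H resolves

fracDim-mod≥k+3 : ∀ k n q r → n ≡ k + 3 + r + suc q * (2 + 2 * k) → k + 3 + r ≤ 2 * k + 1 →
                  FracDimBetween k n (ceilQ k n) (ceilQ k n +ℚ ½)
fracDim-mod≥k+3 k n q r refl bound = subst (λ c → FracDimBetween k n c (c +ℚ ½)) (sym ceil≡)
  (LowerBound⇒≤sumFin (ceiling-lower-bound k n q (r + 3 + 2 * k + q * (2 + 2 * k)) tiles≤a a+k+2≡n) ,
   marksFin k n , marks-resolving k n , QP.≤-reflexive total≡)
  where
  tiles≤a : 2 + k + q * (2 + 2 * k) ≤ r + 3 + 2 * k + q * (2 + 2 * k)
  tiles≤a = ≤-by-+ (r + 1 + k) (2 + k + q * (2 + 2 * k) + (r + 1 + k) ≡ r + 3 + 2 * k + q * (2 + 2 * k) ∋ solve (r ∷ k ∷ q ∷ []))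
  a+k+2≡n : r + 3 + 2 * k + q * (2 + 2 * k) + (2 + k) ≡ k + 3 + r + suc q * (2 + 2 * k)
  a+k+2≡n = solve (r ∷ k ∷ q ∷ [])
  k+3+r≤2+2k : k + 3 + r ≤ 2 + 2 * k
  k+3+r≤2+2k = NP.≤-trans bound (≤-by-+ 1 (2 * k + 1 + 1 ≡ 2 + 2 * k ∋ solve (k ∷ [])))
  r+1≤k : suc r ≤ k
  r+1≤k = NP.+-cancelʳ-≤ (k + 2) (suc r) k (≤-cong k+3+r≤2+2k (solve (r ∷ k ∷ [])) (solve (k ∷ [])))
  ceil≡ : ceilQ k n ≡ (+ suc (suc q)) /ℚ 1
  ceil≡ = ceilQ≡ k n (suc q) (<-by-+ (k + 2 + r) (suc (suc q * (2 + 2 * k) + (k + 2 + r)) ≡ k + 3 + r + suc q * (2 + 2 * k) ∋ solve (r ∷ k ∷ q ∷ [])))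
            (NP.+-monoˡ-≤ (suc q * (2 + 2 * k)) k+3+r≤2+2k)
  total≡ : sumFin n (marksFin k n) ≡ (+ suc (suc q)) /ℚ 1 +ℚ ½
  total≡ = trans (sumFin-marks k n (3 + 2 * q) (suc r) r+1≤k (suc ((3 + 2 * q) * suc k + suc r) ≡ k + 3 + r + suc q * (2 + 2 * k) ∋ solve (r ∷ k ∷ q ∷ [])))
                 (marks-total-half (3 + 2 * q) r (suc (suc q)) (suc (3 + 2 * q) ≡ suc (suc q) + suc (suc q) ∋ solve (q ∷ [])))

-- The middle range: n = 2t + w + 3 and k = t + w

<1+c⇒≡0 : ∀ {L R} s c → L < R → L ≡ s + c → R ≡ 1 + c → s ≡ 0
<1+c⇒≡0 s c L<R refl refl = NP.n<1⇒n≡0 (NP.+-cancelʳ-< c s 1 L<R)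

even≢odd : ∀ a b → a + a ≢ suc (b + b)
even≢odd zero    b       ()
even≢odd (suc a) zero    eq = contradiction (trans (sym (NP.+-suc a a)) (NP.suc-injective eq)) (λ ())
even≢odd (suc a) (suc b) eq =
  even≢odd a b (NP.suc-injective (trans (sym (NP.+-suc a a)) (trans (NP.suc-injective eq) (cong suc (NP.+-suc b b)))))

module MiddleRange (t w : ℕ) where

  k n : ℕ
  k = t + w
  n = t + w + 3 + t

  -- The vertices that carry weight.
  InBlock : ℕ → Set
  InBlock i = t ≤ i × i < t + (w + 3)

  unresolved-left : ∀ x y i → x < y → y < n → InBlock i → i ≤ x → sameDistK k x y i ≡ true →
                    x ≡ t + w + 1 + t × y ≡ t + w + 2 + t × i ≡ t
  unresolved-left x y i x<y y<n (t≤i , _) i≤x unresolved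
    with NP.m≤n⇒∃[o]m+o≡n i≤x | NP.m≤n⇒∃[o]m+o≡n x<y | NP.m≤n⇒∃[o]m+o≡n t≤i
  ... | p , refl | q , refl | a , refl
    with unresolved-view k (t + a + p) (suc (t + a + p) + q) (t + a) unresolved
  ...   | inj₁ same = contradiction (trans (sym (∣m+n-m∣≡n (t + a) p)) (trans same dist-y)) (NP.<⇒≢ (s≤s (NP.m≤m+n p q)))
    where
    dist-y : ∣ suc (t + a + p) + q - t + a ∣ ≡ suc (p + q)
    dist-y = trans (cong (λ m → ∣ m - t + a ∣) (suc (t + a + p) + q ≡ t + a + suc (p + q) ∋ solve (t ∷ a ∷ p ∷ q ∷ [])))
                   (∣m+n-m∣≡n (t + a) (suc (p + q)))
  ...   | inj₂ (far , _) with NP.m≤n⇒∃[o]m+o≡n (subst (suc k ≤_) (∣m+n-m∣≡n (t + a) p) far)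
  ...     | p′ , refl with <1+c⇒≡0 (a + p′ + q) (t + w + 2 + t) y<n
                             (suc (t + a + (suc (t + w) + p′)) + q ≡ (a + p′ + q) + (t + w + 2 + t) ∋ solve (t ∷ w ∷ a ∷ p′ ∷ q ∷ []))
                             (t + w + 3 + t ≡ 1 + (t + w + 2 + t) ∋ solve (t ∷ w ∷ []))
  ...       | a+p′+q≡0 with NP.m+n≡0⇒m≡0 (a + p′) a+p′+q≡0 | NP.m+n≡0⇒n≡0 (a + p′) a+p′+q≡0
  ...         | a+p′≡0 | refl with NP.m+n≡0⇒m≡0 a a+p′≡0 | NP.m+n≡0⇒n≡0 a a+p′≡0
  ...           | refl | refl = (t + 0 + (suc (t + w) + 0) ≡ t + w + 1 + t ∋ solve (t ∷ w ∷ [])) ,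
                                (suc (t + 0 + (suc (t + w) + 0)) + 0 ≡ t + w + 2 + t ∋ solve (t ∷ w ∷ [])) , NP.+-identityʳ t

  unresolved-right : ∀ x y i → x < y → InBlock i → y ≤ i → sameDistK k x y i ≡ true →
                     x ≡ 0 × y ≡ 1 × i ≡ t + w + 2
  unresolved-right x y i x<y (_ , i<end) y≤i unresolved
    with NP.m≤n⇒∃[o]m+o≡n x<y | NP.m≤n⇒∃[o]m+o≡n y≤i
  ... | q , refl | p , refl
    with unresolved-view k x (suc x + q) (suc x + q + p) unresolved
  ...   | inj₁ same = contradiction (trans (sym dist-x) (trans same (NP.∣m-m+n∣≡n (suc x + q) p))) (NP.<⇒≢ (s≤s (NP.m≤n+m p q)) ∘′ sym)
    where
    dist-x : ∣ x - suc x + q + p ∣ ≡ suc (q + p)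
    dist-x = trans (cong (λ m → ∣ x - m ∣) (suc x + q + p ≡ x + suc (q + p) ∋ solve (x ∷ q ∷ p ∷ []))) (NP.∣m-m+n∣≡n x (suc (q + p)))
  ...   | inj₂ (_ , far) with NP.m≤n⇒∃[o]m+o≡n (subst (suc k ≤_) (NP.∣m-m+n∣≡n (suc x + q) p) far)
  ...     | p′ , refl with <1+c⇒≡0 (x + q + p′) (t + w + 2) i<end
                             (suc x + q + (suc (t + w) + p′) ≡ (x + q + p′) + (t + w + 2) ∋ solve (t ∷ w ∷ x ∷ q ∷ p′ ∷ []))
                             (t + (w + 3) ≡ 1 + (t + w + 2) ∋ solve (t ∷ w ∷ []))
  ...       | x+q+p′≡0 with NP.m+n≡0⇒m≡0 (x + q) x+q+p′≡0 | NP.m+n≡0⇒n≡0 (x + q) x+q+p′≡0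
  ...         | x+q≡0 | refl with NP.m+n≡0⇒m≡0 x x+q≡0 | NP.m+n≡0⇒n≡0 x x+q≡0
  ...           | refl | refl = refl , refl , (suc 0 + 0 + (suc (t + w) + 0) ≡ t + w + 2 ∋ solve (t ∷ w ∷ []))

  -- Strictly between x and y, the two distances are at most n − 1 < 2(k + 1) in total,
  -- so they cannot both exceed k: only the midpoint is unresolved.
  unresolved-between : ∀ x y i → y < n → x < i → i ≤ y → sameDistK k x y i ≡ true → x + y ≡ i + i
  unresolved-between x y i y<n x<i i≤y unresolved
    with NP.m≤n⇒∃[o]m+o≡n x<i | NP.m≤n⇒∃[o]m+o≡n i≤y
  ... | a , refl | b , refl
    with unresolved-view k x (suc x + a + b) (suc x + a) unresolved
  ...   | inj₁ same = midpoint x a b (trans (sym dist-x) (trans same (∣m+n-m∣≡n (suc x + a) b)))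
    where
    dist-x : ∣ x - suc x + a ∣ ≡ suc a
    dist-x = trans (cong (λ m → ∣ x - m ∣) (sym (NP.+-suc x a))) (NP.∣m-m+n∣≡n x (suc a))
    midpoint : ∀ x a b → suc a ≡ b → x + (suc x + a + b) ≡ suc x + a + (suc x + a)
    midpoint x a b refl = solve (x ∷ a ∷ [])
  ...   | inj₂ (far-x , far-y)
    with NP.m≤n⇒∃[o]m+o≡n (subst (suc k ≤_) (trans (cong (λ m → ∣ x - m ∣) (sym (NP.+-suc x a))) (NP.∣m-m+n∣≡n x (suc a))) far-x)
       | NP.m≤n⇒∃[o]m+o≡n (subst (suc k ≤_) (∣m+n-m∣≡n (suc x + a) b) far-y)
  ...     | a′ , a≡ | b′ , refl with NP.suc-injective a≡
  ...       | refl with <1+c⇒≡0 (x + a′ + b′ + w) (t + w + 2 + t) y<n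
                         (suc x + (t + w + a′) + (suc (t + w) + b′) ≡ (x + a′ + b′ + w) + (t + w + 2 + t) ∋ solve (t ∷ w ∷ x ∷ a′ ∷ b′ ∷ []))
                         (t + w + 3 + t ≡ 1 + (t + w + 2 + t) ∋ solve (t ∷ w ∷ []))
  ...         | s≡0 with NP.m+n≡0⇒m≡0 (x + a′ + b′) s≡0 | NP.m+n≡0⇒n≡0 (x + a′ + b′) s≡0
  ...           | s₁≡0 | refl with NP.m+n≡0⇒m≡0 (x + a′) s₁≡0 | NP.m+n≡0⇒n≡0 (x + a′) s₁≡0
  ...             | s₂≡0 | refl with NP.m+n≡0⇒m≡0 x s₂≡0 | NP.m+n≡0⇒n≡0 x s₂≡0
  ...               | refl | refl = solve (t ∷ [])

  Unresolved : ℕ → ℕ → ℕ → Set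
  Unresolved x y i = InBlock i × sameDistK k x y i ≡ true

  t+w+1+t≢0 : t + w + 1 + t ≢ 0
  t+w+1+t≢0 eq = contradiction (trans (sym eq) (t + w + 1 + t ≡ suc (t + w + t) ∋ solve (t ∷ w ∷ []))) (λ ())

  unresolved-first-pair : ∀ i → 1 < n → Unresolved 0 1 i → i ≡ t + w + 2
  unresolved-first-pair i 1<n (block , unresolved) with i ℕ.≤? 0 | NP.≤-total 1 i
  ... | yes i≤0 | _        = contradiction (sym (proj₁ (unresolved-left 0 1 i (s≤s z≤n) 1<n block i≤0 unresolved))) t+w+1+t≢0
  ... | no  _   | inj₁ 1≤i = proj₂ (proj₂ (unresolved-right 0 1 i (s≤s z≤n) block 1≤i unresolved))
  ... | no  i≰0 | inj₂ i≤1 = contradiction (sym (unresolved-between 0 1 i 1<n (NP.≰⇒> i≰0) i≤1 unresolved)) (even≢odd i 0)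

  unresolved-last-pair : ∀ x y i → x < y → y < n → x ≡ t + w + 1 + t → Unresolved x y i → i ≡ t
  unresolved-last-pair x y i x<y y<n x≡last (block , unresolved) with i ℕ.≤? x | NP.≤-total y i
  ... | yes i≤x | _        = proj₂ (proj₂ (unresolved-left x y i x<y y<n block i≤x unresolved))
  ... | no  _   | inj₁ y≤i = contradiction (trans (sym x≡last) (proj₁ (unresolved-right x y i x<y block y≤i unresolved))) t+w+1+t≢0
  ... | no  i≰x | inj₂ i≤y = contradiction (trans (sym (unresolved-between x y i y<n (NP.≰⇒> i≰x) i≤y unresolved))
                                                  (trans (cong (λ m → x + m) y≡x+1) (NP.+-suc x x))) (even≢odd i x)
    where
    y≡x+1 : y ≡ suc x
    y≡x+1 = NP.≤-antisym (NP.≤-pred (subst (y <_) n≡ y<n)) x<y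
      where
      n≡ : t + w + 3 + t ≡ suc (suc x)
      n≡ = trans (t + w + 3 + t ≡ suc (suc (t + w + 1 + t)) ∋ solve (t ∷ w ∷ [])) (cong (λ m → suc (suc m)) (sym x≡last))

  unresolved-midpoint : ∀ x y i → x < y → y < n → ¬ (x ≡ 0 × y ≡ 1) → x ≢ t + w + 1 + t →
                        Unresolved x y i → i ≡ (x + y) / 2
  unresolved-midpoint x y i x<y y<n notFirst x≢last (block , unresolved) with i ℕ.≤? x | NP.≤-total y i
  ... | yes i≤x | _        = contradiction (proj₁ (unresolved-left x y i x<y y<n block i≤x unresolved)) x≢last
  ... | no  _   | inj₁ y≤i = contradiction (uncurry (λ x≡0 rest → x≡0 , proj₁ rest) (unresolved-right x y i x<y block y≤i unresolved)) notFirst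
  ... | no  i≰x | inj₂ i≤y = sym (trans (cong (_/ 2) (unresolved-between x y i y<n (NP.≰⇒> i≰x) i≤y unresolved))
                                        (trans (cong (_/ 2) (i + i ≡ i * 2 ∋ solve (i ∷ []))) (DM.m*n/n≡m i 2)))

  at-most-one-unresolved : ∀ x y → x < y → y < n → Σ[ e ∈ ℕ ] (∀ i → Unresolved x y i → i ≡ e)
  at-most-one-unresolved x y x<y y<n with (x ℕ.≟ 0) ×-dec (y ℕ.≟ 1) | x ℕ.≟ t + w + 1 + t
  ... | yes (refl , refl) | _           = t + w + 2 , (λ i → unresolved-first-pair i y<n)
  ... | no  _             | yes x≡last = t , (λ i → unresolved-last-pair x y i x<y y<n x≡last)
  ... | no  notFirst      | no x≢last  = (x + y) / 2 , (λ i → unresolved-midpoint x y i x<y y<n notFirst x≢last)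

  c : ℚ
  c = (+ 1) /ℚ suc (w + 1)

  0≤c : 0ℚ ≤ℚ c
  0≤c = 0≤n/d 1 (w + 1)

  uniform : ℕ → ℚ
  uniform = restrict t (t + (w + 3)) (λ _ → c)

  ∑-uniform : ∑ uniform n ≡ (+ (w + 3)) /ℚ suc (w + 1)
  ∑-uniform = trans (∑-restrict t (w + 3) (λ _ → c) n (≤-by-+ t (t + (w + 3) + t ≡ t + w + 3 + t ∋ solve (t ∷ w ∷ []))))
                    (∑-const-1/d (w + 3) (w + 1))

  uniform-resolves : ∀ x y → x < y → y < n → 1ℚ ≤ℚ weightRℕ k uniform x y n
  uniform-resolves x y x<y y<n with at-most-one-unresolved x y x<y y<n
  ... | e , only-e = +-cancelʳ-≤ 1ℚ (weightRℕ k uniform x y n) c (begin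
    1ℚ +ℚ c                                                               ≡⟨ 1+c≡ ⟩
    (+ (w + 3)) /ℚ suc (w + 1)                                            ≡⟨ sym ∑-uniform ⟩
    ∑ uniform n                                                           ≤⟨ ∑-mono-≤ n (λ i _ → pointwise i) ⟩
    ∑ (λ i → (if sameDistK k x y i then 0ℚ else uniform i) +ℚ point e c i) n ≡⟨ ∑-distrib-+ n _ _ ⟩
    weightRℕ k uniform x y n +ℚ ∑ (point e c) n                           ≤⟨ QP.+-monoʳ-≤ (weightRℕ k uniform x y n) (∑-point-≤ n e 0≤c) ⟩
    weightRℕ k uniform x y n +ℚ c                                         ∎)
    where
    open QP.≤-Reasoning
    1+c≡ : 1ℚ +ℚ c ≡ (+ (w + 3)) /ℚ suc (w + 1)
    1+c≡ = trans (cong (_+ℚ c) (/-≡-crossℕ 1 (2 + w) 0 (w + 1) (1 * suc (w + 1) ≡ (2 + w) * 1 ∋ solve (w ∷ []))))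
                 (trans (/-distrib-+ (+ (2 + w)) (+ 1) (w + 1)) (cong (λ m → (+ m) /ℚ suc (w + 1)) (2 + w + 1 ≡ w + 3 ∋ solve (w ∷ []))))
    pointwise : ∀ i → uniform i ≤ℚ (if sameDistK k x y i then 0ℚ else uniform i) +ℚ point e c i
    pointwise i with sameDistK k x y i in unresolved
    ... | false = p≤p+q (point-nonNeg e 0≤c i)
    ... | true with position t (t + (w + 3)) i
    ...   | below i<t rewrite restrict-below t (t + (w + 3)) (λ _ → c) i<t = subst (0ℚ ≤ℚ_) (sym (QP.+-identityˡ _)) (point-nonNeg e 0≤c i)
    ...   | above end≤i rewrite restrict-above t (t + (w + 3)) (λ _ → c) end≤i = subst (0ℚ ≤ℚ_) (sym (QP.+-identityˡ _)) (point-nonNeg e 0≤c i)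
    ...   | inside t≤i i<end with only-e i ((t≤i , i<end) , unresolved)
    ...     | refl rewrite restrict-inside t (t + (w + 3)) (λ _ → c) t≤i i<end with i ℕ.≟ i
    ...       | yes _ = QP.≤-reflexive (sym (QP.+-identityˡ c))
    ...       | no  i≢i = contradiction refl i≢i

  uniform-resolving : IsResolving k n (λ z → uniform (toℕ z))
  uniform-resolving = resolving-fromℕ k n uniform (restrict-nonNeg t (t + (w + 3)) (λ _ → c) (λ _ → 0≤c)) uniform≤1 uniform-resolves
    where
    uniform≤1 : ∀ i → uniform i ≤ℚ 1ℚ
    uniform≤1 i with position t (t + (w + 3)) i
    ... | below  i<t       rewrite restrict-below t (t + (w + 3)) (λ _ → c) i<t = 0≤1
    ... | above  end≤i     rewrite restrict-above t (t + (w + 3)) (λ _ → c) end≤i = 0≤1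
    ... | inside t≤i i<end rewrite restrict-inside t (t + (w + 3)) (λ _ → c) t≤i i<end = n≤d⇒n/d≤1 1 (w + 1) (s≤s z≤n)

  -- Vertex t+1+i does not resolve its neighbours t+i and t+i+2.
  shared-neighbours : ∀ H (0≤H : ∀ i → 0ℚ ≤ℚ H i) resolves →
                      ∑ (λ _ → 1ℚ) (w + 1) +ℚ ∑ (λ i → H (t + 1 + i)) (w + 1) ≤ℚ ∑ (λ _ → ∑ H n) (w + 1)
  shared-neighbours H 0≤H resolves =
    QP.≤-trans (QP.≤-reflexive (sym (∑-distrib-+ (w + 1) (λ _ → 1ℚ) (λ i → H (t + 1 + i)))))
               (∑-mono-≤ (w + 1) neighbour)
    where
    open Windows k n H 0≤H resolves
    neighbour : ∀ i → i < w + 1 → 1ℚ +ℚ H (t + 1 + i) ≤ℚ total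
    neighbour i i<w+1 = subst (λ m → 1ℚ +ℚ H m ≤ℚ total) (suc (t + i) ≡ t + 1 + i ∋ solve (t ∷ i ∷ []))
      (middlePair (t + i) (NP.≤-trans (≤-cong (NP.+-monoʳ-≤ (t + 3) (NP.≤-pred (subst (suc i ≤_) (NP.+-comm w 1) i<w+1)))
                                              (t + 3 + i ≡ suc (suc (suc (t + i))) ∋ solve (t ∷ i ∷ [])) refl)
                                      (≤-by-+ t (t + 3 + w + t ≡ t + w + 3 + t ∋ solve (t ∷ w ∷ [])))))

  middle-lower-bound : LowerBound k n ((+ (w + 3)) /ℚ suc (w + 1))
  middle-lower-bound H 0≤H resolves = a/1≤d*S⇒a/d≤S (+ (w + 3)) (w + 1) total (+-cancelʳ-≤ _ _ shared (begin
    (+ (w + 3)) /ℚ 1 +ℚ shared                        ≡⟨ cong (_+ℚ shared) (sym 2+ones≡) ⟩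
    ((1ℚ +ℚ 1ℚ) +ℚ ones) +ℚ shared                    ≡⟨ QP.+-assoc (1ℚ +ℚ 1ℚ) ones shared ⟩
    (1ℚ +ℚ 1ℚ) +ℚ (ones +ℚ shared)                    ≤⟨ QP.+-mono-≤ (QP.+-mono-≤ (firstWindow≥1 1<n) (lastWindow≥1 a a+k+2≡n))
                                                                     (shared-neighbours H 0≤H resolves) ⟩
    (mass 0 b +ℚ mass a n) +ℚ ∑ (λ _ → total) (w + 1)  ≡⟨ cong (_+ℚ ∑ (λ _ → total) (w + 1)) windows≡ ⟩
    (total +ℚ shared) +ℚ ∑ (λ _ → total) (w + 1)      ≡⟨ +-swapʳ total shared _ ⟩
    (total +ℚ ∑ (λ _ → total) (w + 1)) +ℚ shared      ≡⟨ cong (_+ℚ shared) (∑-const (suc (w + 1)) total) ⟩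
    ((+ suc (w + 1)) /ℚ 1) *ℚ total +ℚ shared         ∎))
    where
    open Windows k n H 0≤H resolves
    open QP.≤-Reasoning
    a = t + 1
    b = 2 + k
    shared = ∑ (λ i → H (a + i)) (w + 1)
    ones = ∑ (λ _ → 1ℚ) (w + 1)
    b≡a+w+1 : 2 + (t + w) ≡ t + 1 + (w + 1)
    b≡a+w+1 = solve (t ∷ w ∷ [])
    b≤n : b ≤ n
    b≤n = ≤-by-+ (suc t) (2 + (t + w) + suc t ≡ t + w + 3 + t ∋ solve (t ∷ w ∷ []))
    1<n : 1 < n
    1<n = <-by-+ (t + w + 1 + t) (2 + (t + w + 1 + t) ≡ t + w + 3 + t ∋ solve (t ∷ w ∷ []))
    a+k+2≡n : a + (2 + k) ≡ n
    a+k+2≡n = t + 1 + (2 + (t + w)) ≡ t + w + 3 + t ∋ solve (t ∷ w ∷ [])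
    2+ones≡ : (1ℚ +ℚ 1ℚ) +ℚ ones ≡ (+ (w + 3)) /ℚ 1
    2+ones≡ = trans (cong ((1ℚ +ℚ 1ℚ) +ℚ_) (∑-const-1/d (w + 1) 0))
                    (trans (/-distrib-+ (+ 2) (+ (w + 1)) 0) (cong (λ m → (+ m) /ℚ 1) (2 + (w + 1) ≡ w + 3 ∋ solve (w ∷ []))))
    windows≡ : mass 0 b +ℚ mass a n ≡ total +ℚ shared
    windows≡ = trans (mass-overlap a b (≤-by-+ (w + 1) (sym b≡a+w+1)) b≤n)
                     (cong (total +ℚ_) (trans (cong (mass a) b≡a+w+1) (∑-restrict a (w + 1) H n (subst (_≤ n) b≡a+w+1 b≤n))))

  6+2k∸n≡w+3 : 6 + 2 * k ∸ n ≡ w + 3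
  6+2k∸n≡w+3 = trans (cong (_∸ n) (6 + 2 * (t + w) ≡ (t + w + 3 + t) + (w + 3) ∋ solve (t ∷ w ∷ [])))
                     (NP.m+n∸m≡n n (w + 3))

  4+2k∸n≡w+1 : 4 + 2 * k ∸ n ≡ w + 1
  4+2k∸n≡w+1 = trans (cong (_∸ n) (4 + 2 * (t + w) ≡ (t + w + 3 + t) + (w + 1) ∋ solve (t ∷ w ∷ [])))
                     (NP.m+n∸m≡n n (w + 1))

fracDim-medium : ∀ k n → k + 3 ≤ n → n ≤ 2 * k + 3 → FracDimIs k n ((+ (6 + 2 * k ∸ n)) /ℚ suc (4 + 2 * k ∸ n))
fracDim-medium k n k+3≤n n≤2k+3 with NP.m≤n⇒∃[o]m+o≡n k+3≤n
... | t , refl with NP.m≤n⇒∃[o]m+o≡n (NP.+-cancelʳ-≤ (k + 3) t k (≤-cong n≤2k+3 (solve (k ∷ t ∷ [])) (solve (k ∷ []))))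
...   | w , refl rewrite MiddleRange.6+2k∸n≡w+3 t w | MiddleRange.4+2k∸n≡w+1 t w =
  ((λ z → uniform (toℕ z)) , uniform-resolving , trans (sumFin≡∑ n uniform) ∑-uniform) , LowerBound⇒≤sumFin middle-lower-bound
  where open MiddleRange t w using (uniform; uniform-resolving; ∑-uniform; middle-lower-bound)
fracDim-long : ∀ k n → 1 ≤ k → 2 * k + 4 ≤ n →
  (n % (2 + 2 * k) ≡ 1 → FracDimIs k n ((+ (n + k)) /ℚ (2 + 2 * k))) ×
  (2 ≤ n % (2 + 2 * k) → n % (2 + 2 * k) ≤ k + 2 → FracDimIs k n (ceilQ k n)) ×
  (n % (2 + 2 * k) ≡ 0 ⊎ (k + 3 ≤ n % (2 + 2 * k) × n % (2 + 2 * k) ≤ 2 * k + 1) →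
    FracDimBetween k n (ceilQ k n) (ceilQ k n +ℚ ½))
fracDim-long k n 1≤k 2k+4≤n with long-quotient k n 2k+4≤n
... | q , n≡ = mod≡1 , mod≤k+2 , modRest
  where
  r = n % (2 + 2 * k)
  n≡r+[q+1]M : ∀ {r′} → r ≡ r′ → n ≡ r′ + suc q * (2 + 2 * k)
  n≡r+[q+1]M r≡r′ = trans n≡ (cong (_+ suc q * (2 + 2 * k)) r≡r′)
  mod≡1 : r ≡ 1 → FracDimIs k n ((+ (n + k)) /ℚ (2 + 2 * k))
  mod≡1 r≡1 = fracDim-mod≡1 k n q (n≡r+[q+1]M r≡1)
  mod≤k+2 : 2 ≤ r → r ≤ k + 2 → FracDimIs k n (ceilQ k n)
  mod≤k+2 2≤r r≤k+2 with NP.m≤n⇒∃[o]m+o≡n 2≤r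
  ... | r′ , 2+r′≡r = fracDim-mod≤k+2 k n q r′ (n≡r+[q+1]M (sym 2+r′≡r))
                        (NP.+-cancelˡ-≤ 2 r′ k (≤-cong r≤k+2 (sym 2+r′≡r) (NP.+-comm k 2)))
  modRest : r ≡ 0 ⊎ (k + 3 ≤ r × r ≤ 2 * k + 1) → FracDimBetween k n (ceilQ k n) (ceilQ k n +ℚ ½)
  modRest (inj₁ r≡0) = fracDim-mod≡0 k n q 1≤k 2k+4≤n (n≡r+[q+1]M r≡0)
  modRest (inj₂ (k+3≤r , r≤2k+1)) with NP.m≤n⇒∃[o]m+o≡n k+3≤r
  ... | r′ , k+3+r′≡r = fracDim-mod≥k+3 k n q r′ (n≡r+[q+1]M (sym k+3+r′≡r)) (≤-cong r≤2k+1 (sym k+3+r′≡r) refl)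

theorem3p11 : (k n : ℕ) → 1 ≤ k → 2 ≤ n →
    (n ≤ k + 2 → FracDimIs k n 1ℚ) ×
    (k + 3 ≤ n → n ≤ 2 * k + 3 →
      FracDimIs k n ((+ (6 + 2 * k ∸ n)) /ℚ suc (4 + 2 * k ∸ n))) ×
    (2 * k + 4 ≤ n →
      (n % (2 + 2 * k) ≡ 1 →
        FracDimIs k n ((+ (n + k)) /ℚ (2 + 2 * k))) ×
      (2 ≤ n % (2 + 2 * k) → n % (2 + 2 * k) ≤ k + 2 →
        FracDimIs k n (ceilQ k n)) ×
      (n % (2 + 2 * k) ≡ 0 ⊎ (k + 3 ≤ n % (2 + 2 * k) × n % (2 + 2 * k) ≤ 2 * k + 1) →
        FracDimBetween k n (ceilQ k n) (ceilQ k n +ℚ (+ 1 /ℚ 2))))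
theorem3p11 k n 1≤k 2≤n = fracDim-short k n 2≤n , fracDim-medium k n , fracDim-long k n 1≤k
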